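{- For every $n\geq 1$, the map $G\mapsto K(G)$ is a bijection from $\mathcal{T}_n$ (up to isomorphism) onto $\mathcal{A}_n$ (up to isomorphism).
   Context: Graphs are finite, simple and undirected. $T$ denotes the triangle $K_3$. The set $\mathcal{T}$ of graphs is defined recursively: $T\in\mathcal{T}$, and if $H\in\mathcal{T}$, then the graph obtained by identifying a vertex of degree $2$ of $H$ with a vertex of a new (disjoint) copy of $T$ belongs to $\mathcal{T}$. $\mathcal{T}_n$ is the set of graphs in $\mathcal{T}$ containing exactly $n$ triangles. The clique graph $K(G)$ of a graph $G$ has as vertices the maximal complete subgraphs of $G$, two of them adjacent iff they share at least one vertex. $\mathcal{A}_n$ is the set of trees on $n$ vertices with maximum degree at most $3$. -}

module Defs where

open import Data.Nat using (ℕ; zero; suc; _+_; _≤_; _<ᵇ_)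
open import Data.Nat.Properties using ()
open import Data.Fin using (Fin; zero; suc; toℕ; fromℕ; inject₁; _≟_)
open import Data.Bool using (Bool; true; false; if_then_else_; _∧_; not)
open import Data.List using (List; map; allFin)
open import Data.Nat.ListAction using (sum)
open import Data.Product using (Σ; ∃; _×_; _,_)
open import Relation.Nullary using (¬_)
open import Relation.Nullary.Decidable using (⌊_⌋)
open import Relation.Binary.PropositionalEquality using (_≡_; _≢_; refl)
open import Function.Bundles using (_↔_; Inverse; _⇔_)
open import Function.Definitions using (Injective)

record Graph : Set where
  field
    V   : ℕ
    adj : Fin V → Fin V → Bool
    sym : ∀ x y → adj x y ≡ adj y x
    irr : ∀ x → adj x x ≡ false
open Graph public

deg : (G : Graph) → Fin (V G) → ℕ
deg G x = sum (map (λ y → if adj G x y then 1 else 0) (allFin (V G)))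

_≅_ : Graph → Graph → Set
G ≅ H = Σ (Fin (V G) ↔ Fin (V H)) λ f →
          ∀ x y → adj G x y ≡ adj H (Inverse.to f x) (Inverse.to f y)

numTriangles : Graph → ℕ
numTriangles G =
  sum (map (λ i → sum (map (λ j → sum (map (λ k → t i j k) all)) all)) all)
  where
  all = allFin (V G)
  t : Fin (V G) → Fin (V G) → Fin (V G) → ℕ
  t i j k = if (toℕ i <ᵇ toℕ j) ∧ (toℕ j <ᵇ toℕ k)
                 ∧ adj G i j ∧ adj G j k ∧ adj G i k
            then 1 else 0

K3adj : Fin 3 → Fin 3 → Bool
K3adj x y = not ⌊ x ≟ y ⌋

K3sym : ∀ x y → K3adj x y ≡ K3adj y x
K3sym zero zero = refl
K3sym zero (suc zero) = refl
K3sym zero (suc (suc zero)) = refl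
K3sym (suc zero) zero = refl
K3sym (suc zero) (suc zero) = refl
K3sym (suc zero) (suc (suc zero)) = refl
K3sym (suc (suc zero)) zero = refl
K3sym (suc (suc zero)) (suc zero) = refl
K3sym (suc (suc zero)) (suc (suc zero)) = refl

K3irr : ∀ x → K3adj x x ≡ false
K3irr zero = refl
K3irr (suc zero) = refl
K3irr (suc (suc zero)) = refl

K3 : Graph
K3 = record { V = 3 ; adj = K3adj ; sym = K3sym ; irr = K3irr }

-- Attaching a new triangle at vertex x of H: the two new vertices are
-- zero and suc zero; old vertex i becomes suc (suc i). The new triangle is
-- {x, zero, suc zero} (i.e. x is identified with a vertex of a new copy of T).

module _ (H : Graph) (x : Fin (V H)) where
  private
    e : Fin (V H) → Bool
    e i = ⌊ i ≟ x ⌋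

  attachAdj : Fin (suc (suc (V H))) → Fin (suc (suc (V H))) → Bool
  attachAdj zero zero = false
  attachAdj zero (suc zero) = true
  attachAdj zero (suc (suc j)) = e j
  attachAdj (suc zero) zero = true
  attachAdj (suc zero) (suc zero) = false
  attachAdj (suc zero) (suc (suc j)) = e j
  attachAdj (suc (suc i)) zero = e i
  attachAdj (suc (suc i)) (suc zero) = e i
  attachAdj (suc (suc i)) (suc (suc j)) = adj H i j

  attachSym : ∀ a b → attachAdj a b ≡ attachAdj b a
  attachSym zero zero = refl
  attachSym zero (suc zero) = refl
  attachSym zero (suc (suc j)) = refl
  attachSym (suc zero) zero = refl
  attachSym (suc zero) (suc zero) = refl
  attachSym (suc zero) (suc (suc j)) = refl
  attachSym (suc (suc i)) zero = refl
  attachSym (suc (suc i)) (suc zero) = refl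
  attachSym (suc (suc i)) (suc (suc j)) = sym H i j

  attachIrr : ∀ a → attachAdj a a ≡ false
  attachIrr zero = refl
  attachIrr (suc zero) = refl
  attachIrr (suc (suc i)) = irr H i

  attach : Graph
  attach = record { V = suc (suc (V H)) ; adj = attachAdj
                  ; sym = attachSym ; irr = attachIrr }

data InT : Graph → Set where
  base : ∀ {G} → G ≅ K3 → InT G
  step : ∀ {H G} → InT H → (x : Fin (V H)) → deg H x ≡ 2
       → G ≅ attach H x → InT G

InTn : ℕ → Graph → Set
InTn n G = InT G × numTriangles G ≡ n

data Walk (G : Graph) : Fin (V G) → Fin (V G) → Set where
  here  : ∀ x → Walk G x x
  there : ∀ {x y z} → adj G x y ≡ true → Walk G y z → Walk G x z

Connected : Graph → Set
Connected G = ∀ x y → Walk G x y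

HasCycle : Graph → Set
HasCycle G = Σ ℕ λ k → Σ (Fin (suc (suc (suc k))) → Fin (V G)) λ c →
  Injective _≡_ _≡_ c
  × (∀ (i : Fin (suc (suc k))) → adj G (c (inject₁ i)) (c (suc i)) ≡ true)
  × adj G (c (fromℕ (suc (suc k)))) (c zero) ≡ true

IsTree : Graph → Set
IsTree G = Connected G × ¬ HasCycle G

InA : ℕ → Graph → Set
InA n G = V G ≡ n × IsTree G × (∀ x → deg G x ≤ 3)

Subset : Graph → Set
Subset G = Fin (V G) → Bool

IsComplete : (G : Graph) → Subset G → Set
IsComplete G S = ∀ x y → S x ≡ true → S y ≡ true → x ≢ y → adj G x y ≡ true

_⊆_ : {G : Graph} → Subset G → Subset G → Set
S ⊆ S' = ∀ x → S x ≡ true → S' x ≡ true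

IsMaxClique : (G : Graph) → Subset G → Set
IsMaxClique G S = (∃ λ x → S x ≡ true) × IsComplete G S
  × (∀ S' → IsComplete G S' → _⊆_ {G} S S' → _⊆_ {G} S' S)

-- H is (a copy of) the clique graph K(G): its vertices are in bijection,
-- via f, with the maximal cliques of G, and distinct vertices are adjacent
-- iff the corresponding cliques share a vertex.
IsCliqueGraph : Graph → Graph → Set
IsCliqueGraph G H = Σ (Fin (V H) → Subset G) λ f →
    (∀ i → IsMaxClique G (f i))
  × (∀ i j → (∀ x → f i x ≡ f j x) → i ≡ j)
  × (∀ S → IsMaxClique G S → ∃ λ i → ∀ x → f i x ≡ S x)
  × (∀ i j → i ≢ j → (adj H i j ≡ true ⇔ (∃ λ x → f i x ≡ true × f j x ≡ true)))

module Submission where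

-- The proof is organised around one intermediate notion, a *triangle tree*
-- of G with n triangles: a list of n triangles of G that covers every vertex
-- and edge, in which two triangles meet in at most one vertex, every vertex
-- lies in at most two triangles, every triangle of G is one of the list, and
-- whose intersection ("meet") graph is a tree.
--
--   (1) Every G ∈ 𝒯 has a triangle tree (induction on 𝒯: K₃ has one, and
--       attaching a triangle at a degree-2 vertex extends one).
--   (2) If G has a triangle tree with n triangles, then its meet graph is the
--       clique graph K(G), G has exactly n triangles, and every vertex of the
--       meet graph has degree ≤ 3.  This gives K(G) ∈ 𝒜ₙ.
--   (3) An isomorphism between the meet graphs of two triangle trees lifts to
--       an isomorphism of the underlying graphs (shared corners go to shared
--       corners, private corners are matched after sorting the slots).
--   (4) Every tree of maximum degree ≤ 3 is a meet graph: remove a leaf,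
--       build the graph for the smaller tree by induction and attach a
--       triangle at a private corner of the triangle of the leaf's neighbour.

open import Defs hiding (sym)
open import Data.Nat using (ℕ; zero; suc; _+_; _∸_; _≤_; _<_; _<ᵇ_; z≤n; s≤s; s≤s⁻¹; _≟_)
open import Data.Nat.Properties
  using (≤-refl; ≤-trans; ≤-antisym; <-trans; <-irrefl; <-cmp; <⇒≢; <⇒<ᵇ; <ᵇ⇒<;
         n<1+n; +-suc; +-identityʳ; m+[n∸m]≡n; +-monoʳ-<; m≤n⇒m<n∨m≡n)
open import Data.Nat.ListAction using (sum)
open import Data.Fin using (Fin; zero; suc; toℕ; splitAt; fromℕ; fromℕ<; inject₁; punchIn; punchOut)
  renaming (_≟_ to _≟ᶠ_)
open import Data.Fin.Properties
  using (any?; all?; ¬∀⟶∃¬; +↔⊎; injective⇒≤; pigeonhole; suc-injective; toℕ-injective; toℕ<n;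
         toℕ-fromℕ<; toℕ-inject₁; toℕ-fromℕ; punchIn-injective; punchInᵢ≢i; punchOut-cong;
         punchOut-injective; punchIn-punchOut; punchOut-punchIn)
open import Data.Fin.Permutation using (Permutation; ↔⇒≡; transpose) renaming (id to idₚ)
open import Data.Bool using (Bool; true; false; if_then_else_; _∧_; not) renaming (_≟_ to _≟ᵇ_)
open import Data.Bool.Properties using (T-≡)
open import Data.List using (map; allFin)
open import Data.List.Properties using (map-tabulate)
open import Data.Vec using (tabulate; lookup)
open import Data.Vec.Properties using (lookup∘tabulate)
open import Data.Product using (Σ; ∃; _×_; _,_; proj₁; proj₂)
open import Data.Sum using (_⊎_; inj₁; inj₂; [_,_])
open import Data.Sum.Function.Propositional using (_⊎-↔_)
open import Data.Empty using (⊥; ⊥-elim)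
open import Function using (_∘_; id; case_of_)
open import Function.Bundles using (_↔_; _⇔_; Inverse; Injection; mk↔ₛ′; mk⇔; Equivalence)
open import Function.Properties.Inverse using (↔-refl; ↔-sym; ↔-trans; ↔⇒↣)
open import Relation.Nullary using (¬_; yes; no; Dec; does)
open import Relation.Nullary.Decidable using (⌊_⌋; isYes≗does; dec-true; dec-false; does-⇔; ¬?; _×-dec_; _→-dec_)
open import Relation.Binary using (tri<; tri≈; tri>)
open import Relation.Binary.PropositionalEquality
  using (_≡_; _≢_; refl; sym; trans; cong; cong₂; subst; subst₂; module ≡-Reasoning)
open import Axiom.UniquenessOfIdentityProofs.WithK using (uip)

open Inverse using (to; from; strictlyInverseˡ; strictlyInverseʳ)

-- Bijections and finite counting

subset-≡ : ∀ {A : Set} {P : A → Bool} {a b : A} {pa : P a ≡ true} {pb : P b ≡ true} →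
           a ≡ b → _≡_ {A = Σ A (λ z → P z ≡ true)} (a , pa) (b , pb)
subset-≡ {pa = pa} {pb} refl = cong (_ ,_) (uip pa pb)

↔-injective : ∀ {A B : Set} (f : A ↔ B) {x y} → to f x ≡ to f y → x ≡ y
↔-injective f = Injection.injective (↔⇒↣ f)

count : ∀ m → (Fin m → ℕ) → ℕ
count m g = sum (map g (allFin m))

count-suc : ∀ m (g : Fin (suc m) → ℕ) → count (suc m) g ≡ g zero + count m (g ∘ suc)
count-suc m g = cong (λ l → g zero + sum l)
  (trans (map-tabulate suc g) (sym (map-tabulate id (g ∘ suc))))

Σ-split : ∀ {m} (A : Fin (suc m) → Set) → Σ (Fin (suc m)) A ↔ (A zero ⊎ Σ (Fin m) (A ∘ suc))
Σ-split A = mk↔ₛ′ split join split-join join-split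
  where
  split : Σ _ A → _
  split (zero , a) = inj₁ a
  split (suc i , a) = inj₂ (i , a)
  join : _ → Σ _ A
  join (inj₁ a) = zero , a
  join (inj₂ (i , a)) = suc i , a
  split-join : ∀ x → split (join x) ≡ x
  split-join (inj₁ a) = refl
  split-join (inj₂ (i , a)) = refl
  join-split : ∀ x → join (split x) ≡ x
  join-split (zero , a) = refl
  join-split (suc i , a) = refl

Σ-count : ∀ m (A : Fin m → Set) (g : Fin m → ℕ) → (∀ i → A i ↔ Fin (g i)) →
          Σ (Fin m) A ↔ Fin (count m g)
Σ-count zero A g h = mk↔ₛ′ (λ { (() , _) }) (λ ()) (λ ()) (λ { (() , _) })
Σ-count (suc m) A g h =
  subst (λ k → Σ (Fin (suc m)) A ↔ Fin k) (sym (count-suc m g))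
    (↔-trans (Σ-split A)
    (↔-trans (h zero ⊎-↔ Σ-count m (A ∘ suc) (g ∘ suc) (h ∘ suc))
             (↔-sym +↔⊎)))

true↔ : ∀ b → (b ≡ true) ↔ Fin (if b then 1 else 0)
true↔ true = mk↔ₛ′ (λ _ → zero) (λ _ → refl) (λ { zero → refl }) (λ { refl → refl })
true↔ false = mk↔ₛ′ (λ ()) (λ ()) (λ ()) (λ ())

count-true : ∀ m (p : Fin m → Bool) →
             Σ (Fin m) (λ i → p i ≡ true) ↔ Fin (count m (λ i → if p i then 1 else 0))
count-true m p = Σ-count m _ _ (λ i → true↔ (p i))

-- Degrees and triangles as cardinalities

Neighbour : (G : Graph) → Fin (V G) → Set
Neighbour G x = Σ (Fin (V G)) (λ y → adj G x y ≡ true)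

neighbours↔deg : (G : Graph) (x : Fin (V G)) → Neighbour G x ↔ Fin (deg G x)
neighbours↔deg G x = count-true (V G) (adj G x)

deg-≥ : ∀ {k} (G : Graph) (x : Fin (V G)) (h : Fin k → Fin (V G)) →
        (∀ {i j} → h i ≡ h j → i ≡ j) → (∀ i → adj G x (h i) ≡ true) → k ≤ deg G x
deg-≥ G x h h-inj h-adj = injective⇒≤ {f = λ i → to (neighbours↔deg G x) (h i , h-adj i)}
  (λ e → h-inj (cong proj₁ (↔-injective (neighbours↔deg G x) e)))

deg-≤ : ∀ {k} (G : Graph) (x : Fin (V G)) (g : Neighbour G x → Fin k) →
        (∀ {y z} → g y ≡ g z → y ≡ z) → deg G x ≤ k
deg-≤ G x g g-inj = injective⇒≤ {f = g ∘ from (neighbours↔deg G x)}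
  (λ e → ↔-injective (↔-sym (neighbours↔deg G x)) (g-inj e))

pair : ∀ {A : Set} → A → A → Fin 2 → A
pair p q zero = p
pair p q (suc zero) = q

pair-injective : ∀ {A : Set} {p q : A} → p ≢ q → ∀ {i j} → pair p q i ≡ pair p q j → i ≡ j
pair-injective p≢q {zero} {zero} _ = refl
pair-injective p≢q {zero} {suc zero} e = ⊥-elim (p≢q e)
pair-injective p≢q {suc zero} {zero} e = ⊥-elim (p≢q (sym e))
pair-injective p≢q {suc zero} {suc zero} _ = refl

glue : ∀ {A : Set} {k l} → (Fin k → A) → (Fin l → A) → Fin (k + l) → A
glue {k = k} f g i = [ f , g ] (splitAt k i)

glue-injective : ∀ {A : Set} {k l} (f : Fin k → A) (g : Fin l → A) →
  (∀ {i j} → f i ≡ f j → i ≡ j) → (∀ {i j} → g i ≡ g j → i ≡ j) → (∀ i j → f i ≢ g j) →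
  ∀ {i j} → glue f g i ≡ glue f g j → i ≡ j
glue-injective {k = k} {l} f g f-inj g-inj disjoint e = ↔-injective (+↔⊎ {k} {l}) (halves _ _ e)
  where
  halves : ∀ x y → [ f , g ] x ≡ [ f , g ] y → x ≡ y
  halves (inj₁ i) (inj₁ j) e = cong inj₁ (f-inj e)
  halves (inj₁ i) (inj₂ j) e = ⊥-elim (disjoint i j e)
  halves (inj₂ i) (inj₁ j) e = ⊥-elim (disjoint j i (sym e))
  halves (inj₂ i) (inj₂ j) e = cong inj₂ (g-inj e)

isTriangle : (G : Graph) → Fin (V G) → Fin (V G) → Fin (V G) → Bool
isTriangle G i j k = (toℕ i <ᵇ toℕ j) ∧ (toℕ j <ᵇ toℕ k) ∧ adj G i j ∧ adj G j k ∧ adj G i k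

isTriangle-sound : ∀ (G : Graph) {i j k} → isTriangle G i j k ≡ true →
  toℕ i < toℕ j × toℕ j < toℕ k × adj G i j ≡ true × adj G j k ≡ true × adj G i k ≡ true
isTriangle-sound G {i} {j} {k} p with toℕ i <ᵇ toℕ j in i<j | toℕ j <ᵇ toℕ k in j<k
                                  | adj G i j | adj G j k | adj G i k
... | true | true | true | true | true =
  <ᵇ⇒< _ _ (Equivalence.from T-≡ i<j) , <ᵇ⇒< _ _ (Equivalence.from T-≡ j<k) , refl , refl , refl

isTriangle-complete : ∀ (G : Graph) {i j k} → toℕ i < toℕ j → toℕ j < toℕ k →
  adj G i j ≡ true → adj G j k ≡ true → adj G i k ≡ true → isTriangle G i j k ≡ true
isTriangle-complete G i<j j<k ij jk ik
  rewrite Equivalence.to T-≡ (<⇒<ᵇ i<j) | Equivalence.to T-≡ (<⇒<ᵇ j<k) | ij | jk | ik = refl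

Triangle : Graph → Set
Triangle G = Σ (Fin (V G)) λ i → Σ (Fin (V G)) λ j → Σ (Fin (V G)) λ k → isTriangle G i j k ≡ true

triangles↔numTriangles : (G : Graph) → Triangle G ↔ Fin (numTriangles G)
triangles↔numTriangles G =
  Σ-count (V G) _ _ (λ i → Σ-count (V G) _ _ (λ j → count-true (V G) (isTriangle G i j)))

-- Isomorphism invariance

≅-refl : ∀ G → G ≅ G
≅-refl G = ↔-refl , λ x y → refl

≅-sym : ∀ {G H} → G ≅ H → H ≅ G
≅-sym {G} {H} (f , p) = ↔-sym f , λ x y →
  sym (trans (p (from f x) (from f y)) (cong₂ (adj H) (strictlyInverseˡ f x) (strictlyInverseˡ f y)))

≅-trans : ∀ {G H K} → G ≅ H → H ≅ K → G ≅ K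
≅-trans (f , p) (g , q) = ↔-trans f g , λ x y → trans (p x y) (q (to f x) (to f y))

≅-edge : ∀ {G H} (φ : G ≅ H) {x y} → adj G x y ≡ true → adj H (to (proj₁ φ) x) (to (proj₁ φ) y) ≡ true
≅-edge (f , p) {x} {y} e = trans (sym (p x y)) e

≅-edge⁻ : ∀ {G H} (φ : G ≅ H) {x y} → adj H (to (proj₁ φ) x) (to (proj₁ φ) y) ≡ true → adj G x y ≡ true
≅-edge⁻ (f , p) {x} {y} e = trans (p x y) e

neighbours-≅ : ∀ {G H} (φ : G ≅ H) x → Neighbour G x ↔ Neighbour H (to (proj₁ φ) x)
neighbours-≅ {G} {H} φ@(f , p) x = mk↔ₛ′ forth back
  (λ z → subset-≡ {P = adj H (to f x)} (strictlyInverseˡ f (proj₁ z)))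
  (λ y → subset-≡ {P = adj G x} (strictlyInverseʳ f (proj₁ y)))
  where
  forth : Neighbour G x → Neighbour H (to f x)
  forth (y , e) = to f y , ≅-edge {G} {H} φ e
  back : Neighbour H (to f x) → Neighbour G x
  back (z , e) = from f z ,
    ≅-edge⁻ {G} {H} φ (subst (λ w → adj H (to f x) w ≡ true) (sym (strictlyInverseˡ f z)) e)

deg-≅ : ∀ {G H} (φ : G ≅ H) x → deg G x ≡ deg H (to (proj₁ φ) x)
deg-≅ {G} {H} φ x =
  ↔⇒≡ (↔-trans (↔-sym (neighbours↔deg G x)) (↔-trans (neighbours-≅ {G} {H} φ x) (neighbours↔deg H _)))

walk-≅ : ∀ {G H} (φ : G ≅ H) {x y} → Walk G x y → Walk H (to (proj₁ φ) x) (to (proj₁ φ) y)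
walk-≅ φ (here _) = here _
walk-≅ {G} {H} φ (there e w) = there (≅-edge {G} {H} φ e) (walk-≅ φ w)

cycle-≅ : ∀ {G H} (φ : G ≅ H) → HasCycle G → HasCycle H
cycle-≅ {G} {H} φ@(f , p) (k , c , c-inj , c-step , c-close) =
  k , to f ∘ c , (λ e → c-inj (↔-injective f e)) ,
  (λ i → ≅-edge {G} {H} φ (c-step i)) , ≅-edge {G} {H} φ c-close

tree-≅ : ∀ {G H} → G ≅ H → IsTree G → IsTree H
tree-≅ {G} {H} φ@(f , p) (connected , acyclic) =
  (λ x y → subst₂ (Walk H) (strictlyInverseˡ f x) (strictlyInverseˡ f y)
             (walk-≅ φ (connected (from f x) (from f y)))) ,
  (λ cyc → acyclic (cycle-≅ {H} {G} (≅-sym {G} {H} φ) cyc))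

loop-free : ∀ (G : Graph) {u v} → adj G u v ≡ true → u ≢ v
loop-free G {u} e refl with trans (sym e) (irr G u)
... | ()

bool-ext : ∀ {a b : Bool} → (a ≡ true → b ≡ true) → (b ≡ true → a ≡ true) → a ≡ b
bool-ext {true} {true} _ _ = refl
bool-ext {true} {false} f _ = sym (f refl)
bool-ext {false} {true} _ g = g refl
bool-ext {false} {false} _ _ = refl

-- The clique graph is determined up to isomorphism

cliqueGraph-≅ : ∀ {G H H'} → IsCliqueGraph G H → H ≅ H' → IsCliqueGraph G H'
cliqueGraph-≅ {G} {H} {H'} (f , maximal , f-inj , f-onto , f-adj) (φ , pres) =
  f ∘ from φ , maximal ∘ from φ , inj , onto , adjacency
  where
  from-inj : ∀ {i j} → from φ i ≡ from φ j → i ≡ j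
  from-inj = ↔-injective (↔-sym φ)
  inj : ∀ i j → (∀ x → f (from φ i) x ≡ f (from φ j) x) → i ≡ j
  inj i j e = from-inj (f-inj _ _ e)
  onto : ∀ S → IsMaxClique G S → ∃ λ i → ∀ x → f (from φ i) x ≡ S x
  onto S m = let (i , e) = f-onto S m in
    to φ i , λ x → trans (cong (λ z → f z x) (strictlyInverseʳ φ i)) (e x)
  adjacency : ∀ i j → i ≢ j → (adj H' i j ≡ true ⇔ ∃ λ x → f (from φ i) x ≡ true × f (from φ j) x ≡ true)
  adjacency i j i≢j = mk⇔ (λ a → Equivalence.to (f-adj _ _ ne) (trans same a))
                          (λ s → trans (sym same) (Equivalence.from (f-adj _ _ ne) s))
    where
    ne : from φ i ≢ from φ j
    ne e = i≢j (from-inj e)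
    same : adj H (from φ i) (from φ j) ≡ adj H' i j
    same = trans (pres _ _) (cong₂ (adj H') (strictlyInverseˡ φ i) (strictlyInverseˡ φ j))

-- Any two clique graphs of G are isomorphic: match vertices carrying the same clique.
cliqueGraph-unique : ∀ {G H H'} → IsCliqueGraph G H → IsCliqueGraph G H' → H ≅ H'
cliqueGraph-unique {G} {H} {H'} (f , maximal , f-inj , f-onto , f-adj) (g , maximal' , g-inj , g-onto , g-adj) =
  mk↔ₛ′ α β αβ βα , pres
  where
  α : Fin (V H) → Fin (V H')
  α i = proj₁ (g-onto (f i) (maximal i))
  α-same : ∀ i x → g (α i) x ≡ f i x
  α-same i = proj₂ (g-onto (f i) (maximal i))
  β : Fin (V H') → Fin (V H)
  β j = proj₁ (f-onto (g j) (maximal' j))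
  β-same : ∀ j x → f (β j) x ≡ g j x
  β-same j = proj₂ (f-onto (g j) (maximal' j))
  αβ : ∀ j → α (β j) ≡ j
  αβ j = g-inj _ _ λ x → trans (α-same (β j) x) (β-same j x)
  βα : ∀ i → β (α i) ≡ i
  βα i = f-inj _ _ λ x → trans (β-same (α i) x) (α-same i x)
  pres : ∀ i j → adj H i j ≡ adj H' (α i) (α j)
  pres i j with i ≟ᶠ j
  ... | yes refl = trans (irr H i) (sym (irr H' (α i)))
  ... | no i≢j = bool-ext
      (λ a → let (x , p , q) = Equivalence.to (f-adj i j i≢j) a in
             Equivalence.from (g-adj (α i) (α j) α≢) (x , trans (α-same i x) p , trans (α-same j x) q))
      (λ b → let (x , p , q) = Equivalence.to (g-adj (α i) (α j) α≢) b in
             Equivalence.from (f-adj i j i≢j) (x , trans (sym (α-same i x)) p , trans (sym (α-same j x)) q))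
    where
    α≢ : α i ≢ α j
    α≢ e = i≢j (trans (sym (βα i)) (trans (cong β e) (βα j)))

-- Walks and cycles

_++ʷ_ : ∀ {G x y z} → Walk G x y → Walk G y z → Walk G x z
here _ ++ʷ w = w
there e w₁ ++ʷ w₂ = there e (w₁ ++ʷ w₂)

last-or-inject : ∀ {n} (p : Fin (suc n)) → p ≡ fromℕ n ⊎ Σ (Fin n) (λ q → p ≡ inject₁ q)
last-or-inject {zero} zero = inj₁ refl
last-or-inject {suc n} zero = inj₂ (zero , refl)
last-or-inject {suc n} (suc p) with last-or-inject p
... | inj₁ e = inj₁ (cong suc e)
... | inj₂ (q , e) = inj₂ (suc q , cong suc e)

inject₁²≢suc² : ∀ {n} (y : Fin n) → inject₁ (inject₁ y) ≢ suc (suc y)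
inject₁²≢suc² zero ()
inject₁²≢suc² (suc y) e = inject₁²≢suc² y (suc-injective e)

-- Every position on a cycle has two distinct positions adjacent to it;
-- so a vertex with only one neighbour lies on no cycle.
cycle-neighbours : ∀ {G} (h : HasCycle G) → let (k , c , _) = h in
  ∀ p → Σ (Fin (suc (suc (suc k)))) λ q → Σ (Fin (suc (suc (suc k)))) λ r →
        q ≢ r × adj G (c p) (c q) ≡ true × adj G (c p) (c r) ≡ true
cycle-neighbours {G} (k , c , _ , c-step , c-close) zero =
  suc zero , fromℕ (suc (suc k)) , (λ ()) , c-step zero , trans (Graph.sym G _ _) c-close
cycle-neighbours {G} (k , c , _ , c-step , c-close) (suc p) with last-or-inject p
... | inj₁ refl = inject₁ p , zero , (λ ()) , trans (Graph.sym G _ _) (c-step p) , c-close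
... | inj₂ (q , refl) = inject₁ (inject₁ q) , suc (suc q) , inject₁²≢suc² q ,
        trans (Graph.sym G _ _) (c-step (inject₁ q)) , c-step (suc q)

-- Families of triangles and their meet graph
--
-- A family of n triangles in a vertex set Fin W lists the three corners
-- t a 0, t a 1, t a 2 of each triangle a.

Corners : ℕ → ℕ → Set
Corners W n = Fin n → Fin 3 → Fin W

_∈⟨_⟩_ : ∀ {W n} → Fin W → Corners W n → Fin n → Set
v ∈⟨ t ⟩ a = ∃ λ s → t a s ≡ v

-- The decision procedures are opaque: only their correctness matters.
opaque
  corner? : ∀ {W n} (t : Corners W n) v a → Dec (v ∈⟨ t ⟩ a)
  corner? t v a = any? λ s → t a s ≟ᶠ v

Meet : ∀ {W n} → Corners W n → Fin n → Fin n → Set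
Meet t a b = ∃ λ s → ∃ λ s' → t a s ≡ t b s'

opaque
  meet? : ∀ {W n} (t : Corners W n) a b → Dec (Meet t a b)
  meet? t a b = any? λ s → any? λ s' → t a s ≟ᶠ t b s'

meet-sym : ∀ {W n} (t : Corners W n) {a b} → Meet t a b → Meet t b a
meet-sym t (s , s' , e) = s' , s , sym e

meetAdj : ∀ {W n} → Corners W n → Fin n → Fin n → Bool
meetAdj t a b = not (does (a ≟ᶠ b)) ∧ does (meet? t a b)

meetGraph : ∀ {W} n → Corners W n → Graph
meetGraph n t = record
  { V = n ; adj = meetAdj t
  ; sym = λ a b → cong₂ (λ x y → not x ∧ y) (does-⇔ (mk⇔ sym sym) (a ≟ᶠ b) (b ≟ᶠ a))
                                          (does-⇔ (mk⇔ (meet-sym t) (meet-sym t)) (meet? t a b) (meet? t b a))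
  ; irr = λ a → cong (λ x → not x ∧ does (meet? t a a)) (dec-true (a ≟ᶠ a) refl) }

does-sound : ∀ {P : Set} (d : Dec P) → does d ≡ true → P
does-sound (yes p) _ = p
does-sound (no _) ()

meet-edge : ∀ {W n} (t : Corners W n) {a b} → a ≢ b → Meet t a b → adj (meetGraph n t) a b ≡ true
meet-edge t {a} {b} a≢b m = cong₂ (λ x y → not x ∧ y) (dec-false (a ≟ᶠ b) a≢b) (dec-true (meet? t a b) m)

meet-edge⁻ : ∀ {W n} (t : Corners W n) {a b} → adj (meetGraph n t) a b ≡ true → (a ≢ b) × Meet t a b
meet-edge⁻ t {a} {b} e with a ≟ᶠ b | meet? t a b
meet-edge⁻ t {a} {b} () | yes _ | _
meet-edge⁻ t {a} {b} e | no a≢b | m? = a≢b , does-sound m? e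

meetGraph-cong : ∀ {W W' n} (t : Corners W n) (t' : Corners W' n) →
                 (∀ a b → Meet t a b ⇔ Meet t' a b) → meetGraph n t ≅ meetGraph n t'
meetGraph-cong t t' same = ↔-refl , λ a b →
  cong (λ x → not (does (a ≟ᶠ b)) ∧ x) (does-⇔ (same a b) (meet? t a b) (meet? t' a b))

-- Triangle trees

record TriangleTree (G : Graph) (n : ℕ) : Set where
  field
    corner : Corners (V G) n
    corner-injective : ∀ a s s' → corner a s ≡ corner a s' → s ≡ s'
    side : ∀ a s s' → s ≢ s' → adj G (corner a s) (corner a s') ≡ true
    vertex-covered : ∀ v → ∃ λ a → v ∈⟨ corner ⟩ a
    edge-covered : ∀ u v → adj G u v ≡ true → ∃ λ a → u ∈⟨ corner ⟩ a × v ∈⟨ corner ⟩ a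
    meet-≤1 : ∀ a b u v → u ≢ v → u ∈⟨ corner ⟩ a → v ∈⟨ corner ⟩ a →
              u ∈⟨ corner ⟩ b → v ∈⟨ corner ⟩ b → a ≡ b
    at-most-two : ∀ v a b c → v ∈⟨ corner ⟩ a → v ∈⟨ corner ⟩ b → v ∈⟨ corner ⟩ c →
                  a ≡ b ⊎ a ≡ c ⊎ b ≡ c
    triangle-covered : ∀ u v w → adj G u v ≡ true → adj G v w ≡ true → adj G u w ≡ true →
                       ∃ λ a → u ∈⟨ corner ⟩ a × v ∈⟨ corner ⟩ a × w ∈⟨ corner ⟩ a
    meet-tree : IsTree (meetGraph n corner)
open TriangleTree public

corners-adjacent : ∀ {G n} (T : TriangleTree G n) {u v a} →
  u ∈⟨ corner T ⟩ a → v ∈⟨ corner T ⟩ a → u ≢ v → adj G u v ≡ true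
corners-adjacent T (s , refl) (s' , refl) u≢v = side T _ s s' (λ e → u≢v (cong (corner T _) e))

treeOf : ∀ {G n} → TriangleTree G n → Graph
treeOf {n = n} T = meetGraph n (corner T)

K3-triangleTree : TriangleTree K3 1
K3-triangleTree = record
  { corner = λ _ → id
  ; corner-injective = λ a s s' e → e
  ; vertex-covered = λ v → zero , v , refl
  ; side = λ a → distinct-adjacent
  ; edge-covered = λ u v _ → zero , (u , refl) , (v , refl)
  ; meet-≤1 = λ { zero zero _ _ _ _ _ _ _ → refl }
  ; at-most-two = λ { _ zero zero _ _ _ _ → inj₁ refl }
  ; triangle-covered = λ u v w _ _ _ → zero , (u , refl) , (v , refl) , (w , refl)
  ; meet-tree = (λ { zero zero → here zero }) , no-cycle
  }
  where
  distinct-adjacent : ∀ s s' → s ≢ s' → K3adj s s' ≡ true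
  distinct-adjacent s s' s≢s' with s ≟ᶠ s'
  ... | yes e = ⊥-elim (s≢s' e)
  ... | no _ = refl
  -- A cycle needs three distinct vertices, but the meet graph has one.
  no-cycle : ¬ HasCycle (meetGraph 1 (λ _ → id))
  no-cycle (k , c , c-inj , _) = zero≢one (c-inj (single (c zero) (c (suc zero))))
    where
    single : (x y : Fin 1) → x ≡ y
    single zero zero = refl
    zero≢one : _≡_ {A = Fin (suc (suc (suc k)))} zero (suc zero) → ⊥
    zero≢one ()

triangleTree-≅ : ∀ {G G' n} → G ≅ G' → TriangleTree G n → TriangleTree G' n
triangleTree-≅ {G} {G'} {n} φ@(f , pres) T = record
  { corner = t'
  ; corner-injective = λ a s s' e → corner-injective T a s s' (↔-injective f e)
  ; vertex-covered = λ v → let (a , m) = vertex-covered T (from f v) in a , push m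
  ; side = λ a s s' ne → trans (sym (pres _ _)) (side T a s s' ne)
  ; edge-covered = λ u v e → let (a , mu , mv) = edge-covered T _ _ (edge⁻ e) in a , push mu , push mv
  ; meet-≤1 = λ a b u v ne m₁ m₂ m₃ m₄ →
      meet-≤1 T a b _ _ (ne ∘ ↔-injective (↔-sym f)) (pull m₁) (pull m₂) (pull m₃) (pull m₄)
  ; at-most-two = λ v a b c m₁ m₂ m₃ → at-most-two T _ a b c (pull m₁) (pull m₂) (pull m₃)
  ; triangle-covered = λ u v w e₁ e₂ e₃ →
      let (a , mu , mv , mw) = triangle-covered T _ _ _ (edge⁻ e₁) (edge⁻ e₂) (edge⁻ e₃)
      in a , push mu , push mv , push mw
  ; meet-tree = tree-≅ (meetGraph-cong (corner T) t' λ a b →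
      mk⇔ (λ (s , s' , e) → s , s' , cong (to f) e) (λ (s , s' , e) → s , s' , ↔-injective f e)) (meet-tree T)
  }
  where
  t' : Corners (V G') n
  t' a s = to f (corner T a s)
  pull : ∀ {u a} → u ∈⟨ t' ⟩ a → from f u ∈⟨ corner T ⟩ a
  pull (s , e) = s , trans (sym (strictlyInverseʳ f _)) (cong (from f) e)
  push : ∀ {u a} → from f u ∈⟨ corner T ⟩ a → u ∈⟨ t' ⟩ a
  push {u} (s , e) = s , trans (cong (to f) e) (strictlyInverseˡ f u)
  edge⁻ : ∀ {u v} → adj G' u v ≡ true → adj G (from f u) (from f v) ≡ true
  edge⁻ {u} {v} e = trans (pres _ _) (trans (cong₂ (adj G') (strictlyInverseˡ f u) (strictlyInverseˡ f v)) e)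

-- Attaching a triangle at a vertex lying in a single triangle
--
-- If x lies in exactly one triangle a₀ of a triangle tree of H,
-- then the new triangle (index zero) together with the old ones (index suc a)
-- is a triangle tree of attach H x, whose meet graph is the old one with a
-- new leaf zero hanging at suc a₀.

is-x : ∀ {n} (j x : Fin n) → ⌊ j ≟ᶠ x ⌋ ≡ true → j ≡ x
is-x j x e = does-sound (j ≟ᶠ x) (trans (sym (isYes≗does (j ≟ᶠ x))) e)

x-is-x : ∀ {n} (x : Fin n) → ⌊ x ≟ᶠ x ⌋ ≡ true
x-is-x x = trans (isYes≗does (x ≟ᶠ x)) (dec-true (x ≟ᶠ x) refl)

pigeonhole-3-2 : ∀ {A : Set} {z w : A} (a b c : A) → (a ≡ z ⊎ a ≡ w) → (b ≡ z ⊎ b ≡ w) → (c ≡ z ⊎ c ≡ w) →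
                 a ≡ b ⊎ a ≡ c ⊎ b ≡ c
pigeonhole-3-2 a b c (inj₁ p) (inj₁ q) _ = inj₁ (trans p (sym q))
pigeonhole-3-2 a b c (inj₂ p) (inj₂ q) _ = inj₁ (trans p (sym q))
pigeonhole-3-2 a b c (inj₁ p) (inj₂ q) (inj₁ r) = inj₂ (inj₁ (trans p (sym r)))
pigeonhole-3-2 a b c (inj₁ p) (inj₂ q) (inj₂ r) = inj₂ (inj₂ (trans q (sym r)))
pigeonhole-3-2 a b c (inj₂ p) (inj₁ q) (inj₁ r) = inj₂ (inj₂ (trans q (sym r)))
pigeonhole-3-2 a b c (inj₂ p) (inj₁ q) (inj₂ r) = inj₂ (inj₁ (trans p (sym r)))

suc²-injective : ∀ {n} {a b : Fin n} → _≡_ {A = Fin (suc (suc n))} (suc (suc a)) (suc (suc b)) → a ≡ b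
suc²-injective = suc-injective ∘ suc-injective

module Attach (H : Graph) (m : ℕ) (T : TriangleTree H m) (x : Fin (V H)) (a₀ : Fin m)
              (x∈a₀ : x ∈⟨ corner T ⟩ a₀) (only-a₀ : ∀ a → x ∈⟨ corner T ⟩ a → a ≡ a₀) where

  G : Graph
  G = attach H x

  old : Fin (V H) → Fin (V G)
  old v = suc (suc v)

  t : Corners (V G) (suc m)
  t zero zero = old x
  t zero (suc zero) = zero
  t zero (suc (suc zero)) = suc zero
  t (suc a) s = old (corner T a s)

  0∈new : zero ∈⟨ t ⟩ zero
  0∈new = suc zero , refl
  1∈new : suc zero ∈⟨ t ⟩ zero
  1∈new = suc (suc zero) , refl
  x∈new : old x ∈⟨ t ⟩ zero
  x∈new = zero , refl

  old∈ : ∀ {w a} → w ∈⟨ corner T ⟩ a → old w ∈⟨ t ⟩ suc a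
  old∈ (s , e) = s , cong old e
  old∈⁻ : ∀ {w a} → old w ∈⟨ t ⟩ suc a → w ∈⟨ corner T ⟩ a
  old∈⁻ (s , e) = s , suc²-injective e

  ∈old : ∀ {v a} → v ∈⟨ t ⟩ suc a → Σ (Fin (V H)) λ w → v ≡ old w × w ∈⟨ corner T ⟩ a
  ∈old (s , refl) = corner T _ s , refl , s , refl

  old∈new : ∀ {w} → old w ∈⟨ t ⟩ zero → w ≡ x
  old∈new (zero , e) = sym (suc²-injective e)
  old∈new (suc zero , ())
  old∈new (suc (suc zero) , ())

  triangles-at-x : ∀ d → old x ∈⟨ t ⟩ d → d ≡ zero ⊎ d ≡ suc a₀
  triangles-at-x zero _ = inj₁ refl
  triangles-at-x (suc d) m = inj₂ (cong suc (only-a₀ d (old∈⁻ m)))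

  triangles-away-from-x : ∀ {w} d → w ≢ x → old w ∈⟨ t ⟩ d →
                          Σ (Fin m) λ d' → d ≡ suc d' × w ∈⟨ corner T ⟩ d'
  triangles-away-from-x zero w≢x m = ⊥-elim (w≢x (old∈new m))
  triangles-away-from-x (suc d) w≢x m = d , refl , old∈⁻ m

  nbr-of-0 : ∀ v → adj G zero v ≡ true → v ∈⟨ t ⟩ zero
  nbr-of-0 zero ()
  nbr-of-0 (suc zero) _ = 1∈new
  nbr-of-0 (suc (suc j)) e = subst (λ z → old z ∈⟨ t ⟩ zero) (sym (is-x j x e)) x∈new

  nbr-of-1 : ∀ v → adj G (suc zero) v ≡ true → v ∈⟨ t ⟩ zero
  nbr-of-1 zero _ = 0∈new
  nbr-of-1 (suc zero) ()
  nbr-of-1 (suc (suc j)) e = subst (λ z → old z ∈⟨ t ⟩ zero) (sym (is-x j x e)) x∈new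

  flip : ∀ u v → adj G u v ≡ true → adj G v u ≡ true
  flip u v e = trans (Graph.sym G v u) e

  t-injective : ∀ a s s' → t a s ≡ t a s' → s ≡ s'
  t-injective zero zero zero _ = refl
  t-injective zero zero (suc zero) ()
  t-injective zero zero (suc (suc zero)) ()
  t-injective zero (suc zero) zero ()
  t-injective zero (suc zero) (suc zero) _ = refl
  t-injective zero (suc zero) (suc (suc zero)) ()
  t-injective zero (suc (suc zero)) zero ()
  t-injective zero (suc (suc zero)) (suc zero) ()
  t-injective zero (suc (suc zero)) (suc (suc zero)) _ = refl
  t-injective (suc a) s s' e = corner-injective T a s s' (suc²-injective e)

  t-covered : ∀ v → ∃ λ a → v ∈⟨ t ⟩ a
  t-covered zero = zero , 0∈new
  t-covered (suc zero) = zero , 1∈new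
  t-covered (suc (suc v)) = let (a , m) = vertex-covered T v in suc a , old∈ m

  t-side : ∀ a s s' → s ≢ s' → adj G (t a s) (t a s') ≡ true
  t-side zero zero zero ne = ⊥-elim (ne refl)
  t-side zero zero (suc zero) _ = x-is-x x
  t-side zero zero (suc (suc zero)) _ = x-is-x x
  t-side zero (suc zero) zero _ = x-is-x x
  t-side zero (suc zero) (suc zero) ne = ⊥-elim (ne refl)
  t-side zero (suc zero) (suc (suc zero)) _ = refl
  t-side zero (suc (suc zero)) zero _ = x-is-x x
  t-side zero (suc (suc zero)) (suc zero) _ = refl
  t-side zero (suc (suc zero)) (suc (suc zero)) ne = ⊥-elim (ne refl)
  t-side (suc a) s s' ne = side T a s s' ne

  t-edge-covered : ∀ u v → adj G u v ≡ true → ∃ λ a → u ∈⟨ t ⟩ a × v ∈⟨ t ⟩ a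
  t-edge-covered zero v e = zero , 0∈new , nbr-of-0 v e
  t-edge-covered (suc zero) v e = zero , 1∈new , nbr-of-1 v e
  t-edge-covered (suc (suc i)) zero e = zero , nbr-of-0 _ (flip (old i) zero e) , 0∈new
  t-edge-covered (suc (suc i)) (suc zero) e = zero , nbr-of-1 _ (flip (old i) (suc zero) e) , 1∈new
  t-edge-covered (suc (suc i)) (suc (suc j)) e =
    let (a , p , q) = edge-covered T i j e in suc a , old∈ p , old∈ q

  -- Two distinct vertices shared by the new triangle and an old one would both be x.
  t-meet-≤1 : ∀ a b u v → u ≢ v → u ∈⟨ t ⟩ a → v ∈⟨ t ⟩ a → u ∈⟨ t ⟩ b → v ∈⟨ t ⟩ b → a ≡ b
  t-meet-≤1 zero zero u v ne p q r s = refl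
  t-meet-≤1 zero (suc b) u v ne p q r s with ∈old r | ∈old s
  ... | (w , refl , _) | (w' , refl , _) = ⊥-elim (ne (cong old (trans (old∈new p) (sym (old∈new q)))))
  t-meet-≤1 (suc a) zero u v ne p q r s with ∈old p | ∈old q
  ... | (w , refl , _) | (w' , refl , _) = ⊥-elim (ne (cong old (trans (old∈new r) (sym (old∈new s)))))
  t-meet-≤1 (suc a) (suc b) u v ne p q r s with ∈old p | ∈old q
  ... | (w , refl , p') | (w' , refl , q') =
    cong suc (meet-≤1 T a b w w' (ne ∘ cong old) p' q' (old∈⁻ r) (old∈⁻ s))

  -- x is in the new triangle and a₀ only; other old vertices keep their triangles.
  t-at-most-two : ∀ v a b c → v ∈⟨ t ⟩ a → v ∈⟨ t ⟩ b → v ∈⟨ t ⟩ c → a ≡ b ⊎ a ≡ c ⊎ b ≡ c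
  t-at-most-two zero zero zero c _ _ _ = inj₁ refl
  t-at-most-two zero (suc a) b c (_ , ()) _ _
  t-at-most-two zero zero (suc b) c _ (_ , ()) _
  t-at-most-two (suc zero) zero zero c _ _ _ = inj₁ refl
  t-at-most-two (suc zero) (suc a) b c (_ , ()) _ _
  t-at-most-two (suc zero) zero (suc b) c _ (_ , ()) _
  t-at-most-two (suc (suc w)) a b c p q r with w ≟ᶠ x
  ... | yes refl = pigeonhole-3-2 a b c (triangles-at-x a p) (triangles-at-x b q) (triangles-at-x c r)
  ... | no w≢x with triangles-away-from-x a w≢x p | triangles-away-from-x b w≢x q
                  | triangles-away-from-x c w≢x r
  ... | (a' , refl , p') | (b' , refl , q') | (c' , refl , r') with at-most-two T w a' b' c' p' q' r'
  ... | inj₁ e = inj₁ (cong suc e)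
  ... | inj₂ (inj₁ e) = inj₂ (inj₁ (cong suc e))
  ... | inj₂ (inj₂ e) = inj₂ (inj₂ (cong suc e))

  -- A triangle through a new vertex is the new triangle; otherwise it is old.
  t-triangle-covered : ∀ u v w → adj G u v ≡ true → adj G v w ≡ true → adj G u w ≡ true →
                       ∃ λ a → u ∈⟨ t ⟩ a × v ∈⟨ t ⟩ a × w ∈⟨ t ⟩ a
  t-triangle-covered zero v w e₁ e₂ e₃ = zero , 0∈new , nbr-of-0 v e₁ , nbr-of-0 w e₃
  t-triangle-covered (suc zero) v w e₁ e₂ e₃ = zero , 1∈new , nbr-of-1 v e₁ , nbr-of-1 w e₃
  t-triangle-covered (suc (suc i)) zero w e₁ e₂ e₃ =
    zero , nbr-of-0 _ (flip (old i) zero e₁) , 0∈new , nbr-of-0 w e₂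
  t-triangle-covered (suc (suc i)) (suc zero) w e₁ e₂ e₃ =
    zero , nbr-of-1 _ (flip (old i) (suc zero) e₁) , 1∈new , nbr-of-1 w e₂
  t-triangle-covered (suc (suc i)) (suc (suc j)) zero e₁ e₂ e₃ =
    zero , nbr-of-0 _ (flip (old i) zero e₃) , nbr-of-0 _ (flip (old j) zero e₂) , 0∈new
  t-triangle-covered (suc (suc i)) (suc (suc j)) (suc zero) e₁ e₂ e₃ =
    zero , nbr-of-1 _ (flip (old i) (suc zero) e₃) , nbr-of-1 _ (flip (old j) (suc zero) e₂) , 1∈new
  t-triangle-covered (suc (suc i)) (suc (suc j)) (suc (suc k)) e₁ e₂ e₃ =
    let (a , p , q , r) = triangle-covered T i j k e₁ e₂ e₃ in suc a , old∈ p , old∈ q , old∈ r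

  M : Graph
  M = meetGraph (suc m) t

  meet-old : ∀ a b → adj (M) (suc a) (suc b) ≡ adj (treeOf T) a b
  meet-old a b = bool-ext
    (λ e → let (ne , s , s' , q) = meet-edge⁻ t e in
           meet-edge (corner T) (ne ∘ cong suc) (s , s' , suc²-injective q))
    (λ e → let (ne , s , s' , q) = meet-edge⁻ (corner T) e in
           meet-edge t (ne ∘ suc-injective) (s , s' , cong old q))

  meet-new-a₀ : adj (M) zero (suc a₀) ≡ true
  meet-new-a₀ = meet-edge t {zero} {suc a₀} (λ ()) (zero , proj₁ x∈a₀ , cong old (sym (proj₂ x∈a₀)))

  meet-new-only-a₀ : ∀ d → adj (M) zero d ≡ true → d ≡ suc a₀
  meet-new-only-a₀ d e with meet-edge⁻ t {zero} {d} e
  meet-new-only-a₀ zero e | ne , _ = ⊥-elim (ne refl)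
  meet-new-only-a₀ (suc a) e | _ , zero , s' , q = cong suc (only-a₀ a (s' , sym (suc²-injective q)))
  meet-new-only-a₀ (suc a) e | _ , suc zero , s' , ()
  meet-new-only-a₀ (suc a) e | _ , suc (suc zero) , s' , ()

  lift-walk : ∀ {a b} → Walk (treeOf T) a b → Walk (M) (suc a) (suc b)
  lift-walk (here a) = here (suc a)
  lift-walk (there {a} {b} e w) = there (trans (meet-old a b) e) (lift-walk w)

  t-connected : Connected (M)
  t-connected zero zero = here zero
  t-connected zero (suc b) = there meet-new-a₀ (lift-walk (proj₁ (meet-tree T) a₀ b))
  t-connected (suc a) zero = lift-walk (proj₁ (meet-tree T) a a₀) ++ʷ
    there (trans (Graph.sym (M) (suc a₀) zero) meet-new-a₀) (here zero)
  t-connected (suc a) (suc b) = lift-walk (proj₁ (meet-tree T) a b)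

  -- A cycle cannot pass through the new leaf (it has one neighbour), so it
  -- would be a cycle among the old triangles.
  t-acyclic : ¬ HasCycle (M)
  t-acyclic cyc@(k , c , c-inj , c-step , c-close) with any? (λ i → c i ≟ᶠ zero)
  ... | yes (p , cp) =
    let (q , r , q≢r , e₁ , e₂) = cycle-neighbours {M} cyc p
        at-leaf : ∀ {q} → adj (M) (c p) (c q) ≡ true → c q ≡ suc a₀
        at-leaf {q} e = meet-new-only-a₀ _ (subst (λ z → adj (M) z (c q) ≡ true) cp e)
    in q≢r (c-inj (trans (at-leaf e₁) (sym (at-leaf e₂))))
  ... | no avoids-new = proj₂ (meet-tree T) (k , c' , c'-inj , (λ i → down (c-step i)) , down c-close)
    where
    pred : (d : Fin (suc m)) → d ≢ zero → Σ (Fin m) λ d' → d ≡ suc d'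
    pred zero ne = ⊥-elim (ne refl)
    pred (suc d) _ = d , refl
    c' : Fin (suc (suc (suc k))) → Fin m
    c' i = proj₁ (pred (c i) (λ e → avoids-new (i , e)))
    c≡ : ∀ i → c i ≡ suc (c' i)
    c≡ i = proj₂ (pred (c i) (λ e → avoids-new (i , e)))
    c'-inj : ∀ {i j} → c' i ≡ c' j → i ≡ j
    c'-inj {i} {j} e = c-inj (trans (c≡ i) (trans (cong suc e) (sym (c≡ j))))
    down : ∀ {i j} → adj (M) (c i) (c j) ≡ true → adj (treeOf T) (c' i) (c' j) ≡ true
    down {i} {j} e = trans (sym (meet-old _ _)) (subst₂ (λ u v → adj (M) u v ≡ true) (c≡ i) (c≡ j) e)

  extended : TriangleTree G (suc m)
  extended = record
    { corner = t ; corner-injective = t-injective ; vertex-covered = t-covered ; side = t-side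
    ; edge-covered = t-edge-covered ; meet-≤1 = t-meet-≤1 ; at-most-two = t-at-most-two
    ; triangle-covered = t-triangle-covered ; meet-tree = t-connected , t-acyclic }

-- Every graph of 𝒯 has a triangle tree

module _ {G : Graph} {n : ℕ} (T : TriangleTree G n) where

  others : Fin n → Fin 3 → Fin 2 → Fin (V G)
  others a s = corner T a ∘ punchIn s

  others-injective : ∀ a s {i j} → others a s i ≡ others a s j → i ≡ j
  others-injective a s e = punchIn-injective s _ _ (corner-injective T a _ _ e)

  others-≢ : ∀ a s i → corner T a s ≢ others a s i
  others-≢ a s i e = punchInᵢ≢i s i (sym (corner-injective T a _ _ e))

  others-adjacent : ∀ a s i → adj G (corner T a s) (others a s i) ≡ true
  others-adjacent a s i = side T a s _ (λ e → punchInᵢ≢i s i (sym e))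

  others-∈ : ∀ a s i → others a s i ∈⟨ corner T ⟩ a
  others-∈ a s i = punchIn s i , refl

  -- A vertex in two distinct triangles sees the two other corners of each, four in all.
  two-triangles⇒deg≥4 : ∀ {x a b} → x ∈⟨ corner T ⟩ a → x ∈⟨ corner T ⟩ b → a ≢ b → 4 ≤ deg G x
  two-triangles⇒deg≥4 {a = a} {b} (s , refl) (s' , x≡) a≢b =
    deg-≥ G _ (glue (others a s) (others b s'))
      (glue-injective _ _ (others-injective a s) (others-injective b s') disjoint) adjacent
    where
    disjoint : ∀ i j → others a s i ≢ others b s' j
    disjoint i j e = a≢b (meet-≤1 T a b _ _ (others-≢ a s i) (s , refl) (others-∈ a s i) (s' , x≡)
                         (subst (_∈⟨ corner T ⟩ b) (sym e) (others-∈ b s' j)))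
    adjacent : ∀ i → adj G (corner T a s) (glue (others a s) (others b s') i) ≡ true
    adjacent i with splitAt 2 i
    ... | inj₁ j = others-adjacent a s j
    ... | inj₂ j = subst (λ z → adj G z (others b s' j) ≡ true) x≡ (others-adjacent b s' j)

  deg2⇒one-triangle : ∀ x → deg G x ≡ 2 → ∀ {a b} → x ∈⟨ corner T ⟩ a → x ∈⟨ corner T ⟩ b → a ≡ b
  deg2⇒one-triangle x d {a} {b} x∈a x∈b with a ≟ᶠ b
  ... | yes a≡b = a≡b
  ... | no a≢b with subst (4 ≤_) d (two-triangles⇒deg≥4 x∈a x∈b a≢b)
  ... | s≤s (s≤s ())

  -- Conversely a corner in a single triangle sees exactly the two other corners.
  one-triangle⇒deg2 : ∀ a s → (∀ c → corner T a s ∈⟨ corner T ⟩ c → c ≡ a) → deg G (corner T a s) ≡ 2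
  one-triangle⇒deg2 a s only-a = ≤-antisym at-most-2 at-least-2
    where
    x : Fin (V G)
    x = corner T a s
    at-least-2 : 2 ≤ deg G x
    at-least-2 = deg-≥ G x (others a s) (others-injective a s) (others-adjacent a s)
    -- Every neighbour of x is another corner of a.
    slot-of : (y : Neighbour G x) → Σ (Fin 3) λ s' → corner T a s' ≡ proj₁ y × s ≢ s'
    slot-of (y , e) with edge-covered T x y e
    ... | (c , x∈c , s' , y≡) with only-a c x∈c
    ... | refl = s' , y≡ , λ s≡s' → loop-free G e (trans (cong (corner T a) s≡s') y≡)
    label : Neighbour G x → Fin 2
    label y = punchOut (proj₂ (proj₂ (slot-of y)))
    label-injective : ∀ {y z} → label y ≡ label z → y ≡ z
    label-injective {y} {z} e with slot-of y | slot-of z | e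
    ... | (s' , y≡ , s≢s') | (s'' , z≡ , s≢s'') | e' =
      subset-≡ {P = adj G x}
        (trans (sym y≡) (trans (cong (corner T a) (punchOut-injective s≢s' s≢s'' e')) z≡))
    at-most-2 : deg G x ≤ 2
    at-most-2 = deg-≤ G x label label-injective

triangleTree-of-𝒯 : ∀ {G} → InT G → Σ ℕ (TriangleTree G)
triangleTree-of-𝒯 {G} (base φ) = 1 , triangleTree-≅ (≅-sym {G} {K3} φ) K3-triangleTree
triangleTree-of-𝒯 {G} (step {H} T∈ x deg-x φ) =
  let (m , T) = triangleTree-of-𝒯 T∈
      (a₀ , x∈a₀) = vertex-covered T x
  in suc m , triangleTree-≅ (≅-sym {G} {attach H x} φ)
               (Attach.extended H m T x a₀ x∈a₀ (λ a x∈a → deg2⇒one-triangle T x deg-x x∈a x∈a₀))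

-- Sorting three distinct vertices

_∈₃_ : ∀ {N} → Fin N → Fin N × Fin N × Fin N → Set
x ∈₃ (a , b , c) = x ≡ a ⊎ x ≡ b ⊎ x ≡ c

₁ : ∀ {N} {a b c : Fin N} → a ∈₃ (a , b , c)
₁ = inj₁ refl
₂ : ∀ {N} {a b c : Fin N} → b ∈₃ (a , b , c)
₂ = inj₂ (inj₁ refl)
₃ : ∀ {N} {a b c : Fin N} → c ∈₃ (a , b , c)
₃ = inj₂ (inj₂ refl)

record Sorting {N} (u v w : Fin N) : Set where
  constructor sorting
  field
    i j k : Fin N
    i<j : toℕ i < toℕ j
    j<k : toℕ j < toℕ k
    i∈ : i ∈₃ (u , v , w)
    j∈ : j ∈₃ (u , v , w)
    k∈ : k ∈₃ (u , v , w)
    u∈ : u ∈₃ (i , j , k)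
    v∈ : v ∈₃ (i , j , k)
    w∈ : w ∈₃ (i , j , k)

compare-≢ : ∀ {N} (x y : Fin N) → x ≢ y → toℕ x < toℕ y ⊎ toℕ y < toℕ x
compare-≢ x y x≢y with <-cmp (toℕ x) (toℕ y)
... | tri< lt _ _ = inj₁ lt
... | tri≈ _ eq _ = ⊥-elim (x≢y (toℕ-injective eq))
... | tri> _ _ gt = inj₂ gt

sort3 : ∀ {N} (u v w : Fin N) → u ≢ v → v ≢ w → u ≢ w → Sorting u v w
sort3 u v w u≢v v≢w u≢w with compare-≢ u v u≢v | compare-≢ v w v≢w
... | inj₁ uv | inj₁ vw = sorting u v w uv vw ₁ ₂ ₃ ₁ ₂ ₃
... | inj₂ vu | inj₂ wv = sorting w v u wv vu ₃ ₂ ₁ ₃ ₂ ₁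
... | inj₁ uv | inj₂ wv with compare-≢ u w u≢w
...   | inj₁ uw = sorting u w v uw wv ₁ ₃ ₂ ₁ ₃ ₂
...   | inj₂ wu = sorting w u v wu uv ₃ ₁ ₂ ₂ ₃ ₁
sort3 u v w u≢v v≢w u≢w | inj₂ vu | inj₁ vw with compare-≢ u w u≢w
...   | inj₁ uw = sorting v u w vu uw ₂ ₁ ₃ ₂ ₁ ₃
...   | inj₂ wu = sorting v w u vw wu ₂ ₃ ₁ ₃ ₁ ₂

above-max : ∀ {N} {i' j' k' y : Fin N} → toℕ i' < toℕ j' → toℕ j' < toℕ k' → toℕ k' < toℕ y →
            y ∈₃ (i' , j' , k') → ⊥
above-max i'<j' j'<k' k'<y (inj₁ refl) = <-irrefl refl (<-trans k'<y (<-trans i'<j' j'<k'))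
above-max i'<j' j'<k' k'<y (inj₂ (inj₁ refl)) = <-irrefl refl (<-trans k'<y j'<k')
above-max i'<j' j'<k' k'<y (inj₂ (inj₂ refl)) = <-irrefl refl k'<y

sorting-unique : ∀ {N} {i j k i' j' k' : Fin N} → toℕ i < toℕ j → toℕ j < toℕ k →
  toℕ i' < toℕ j' → toℕ j' < toℕ k' →
  i ∈₃ (i' , j' , k') → j ∈₃ (i' , j' , k') → k ∈₃ (i' , j' , k') → i ≡ i' × j ≡ j' × k ≡ k'
sorting-unique i<j j<k p q (inj₁ refl) (inj₁ refl) _ = ⊥-elim (<-irrefl refl i<j)
sorting-unique i<j j<k p q (inj₁ refl) (inj₂ (inj₁ refl)) (inj₁ refl) =
  ⊥-elim (<-irrefl refl (<-trans p j<k))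
sorting-unique i<j j<k p q (inj₁ refl) (inj₂ (inj₁ refl)) (inj₂ (inj₁ refl)) = ⊥-elim (<-irrefl refl j<k)
sorting-unique i<j j<k p q (inj₁ refl) (inj₂ (inj₁ refl)) (inj₂ (inj₂ refl)) = refl , refl , refl
sorting-unique i<j j<k p q _ (inj₂ (inj₂ refl)) k∈ = ⊥-elim (above-max p q j<k k∈)
sorting-unique i<j j<k p q (inj₂ (inj₁ refl)) (inj₁ refl) _ = ⊥-elim (<-irrefl refl (<-trans p i<j))
sorting-unique i<j j<k p q (inj₂ (inj₁ refl)) (inj₂ (inj₁ refl)) _ = ⊥-elim (<-irrefl refl i<j)
sorting-unique i<j j<k p q (inj₂ (inj₂ refl)) j∈ _ = ⊥-elim (above-max p q i<j j∈)

-- The meet graph of a triangle tree is the clique graph, and counts triangles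

module CliquesOf {G : Graph} {n : ℕ} (T : TriangleTree G n) where

  private
    t : Corners (V G) n
    t = corner T

  triangleSet : Fin n → Subset G
  triangleSet a v = does (corner? t v a)

  ∈set : ∀ {v a} → v ∈⟨ t ⟩ a → triangleSet a v ≡ true
  ∈set {v} {a} = dec-true (corner? t v a)

  set∈ : ∀ {v a} → triangleSet a v ≡ true → v ∈⟨ t ⟩ a
  set∈ {v} {a} = does-sound (corner? t v a)

  corner₀≢corner₁ : ∀ a → t a zero ≢ t a (suc zero)
  corner₀≢corner₁ a e with corner-injective T a zero (suc zero) e
  ... | ()

  -- A vertex adjacent to two corners of a lies in a (the three span a triangle of G).
  adjacent-to-two-corners : ∀ a y → adj G y (t a zero) ≡ true → adj G y (t a (suc zero)) ≡ true →
                            y ∈⟨ t ⟩ a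
  adjacent-to-two-corners a y e₀ e₁ =
    let (c , y∈c , c₀∈c , c₁∈c) = triangle-covered T y (t a zero) (t a (suc zero)) e₀
                                    (side T a zero (suc zero) (λ ())) e₁
        c≡a = meet-≤1 T c a _ _ (corner₀≢corner₁ a) c₀∈c c₁∈c (zero , refl) (suc zero , refl)
    in subst (y ∈⟨ t ⟩_) c≡a y∈c

  triangle-maximal : ∀ a → IsMaxClique G (triangleSet a)
  triangle-maximal a = (t a zero , ∈set (zero , refl)) , complete , maximal
    where
    complete : IsComplete G (triangleSet a)
    complete x y px py x≢y = corners-adjacent T (set∈ px) (set∈ py) x≢y
    maximal : ∀ S → IsComplete G S → _⊆_ {G} (triangleSet a) S → _⊆_ {G} S (triangleSet a)
    maximal S S-complete a⊆S y Sy with y ≟ᶠ t a zero | y ≟ᶠ t a (suc zero)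
    ... | yes e | _ = ∈set (zero , sym e)
    ... | no _ | yes e = ∈set (suc zero , sym e)
    ... | no y≢₀ | no y≢₁ = ∈set (adjacent-to-two-corners a y
          (S-complete y _ Sy (a⊆S _ (∈set (zero , refl))) y≢₀)
          (S-complete y _ Sy (a⊆S _ (∈set (suc zero , refl))) y≢₁))

  complete-through-edge : ∀ S → IsComplete G S → ∀ u w b → S u ≡ true → S w ≡ true → u ≢ w →
                          u ∈⟨ t ⟩ b → w ∈⟨ t ⟩ b → ∀ y → S y ≡ true → y ∈⟨ t ⟩ b
  complete-through-edge S S-complete u w b Su Sw u≢w u∈b w∈b y Sy with y ≟ᶠ u | y ≟ᶠ w
  ... | yes refl | _ = u∈b
  ... | no _ | yes refl = w∈b
  ... | no y≢u | no y≢w =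
    let (c , u∈c , w∈c , y∈c) = triangle-covered T u w y (S-complete u w Su Sw u≢w)
                                  (S-complete w y Sw Sy (y≢w ∘ sym)) (S-complete u y Su Sy (y≢u ∘ sym))
    in subst (y ∈⟨ t ⟩_) (meet-≤1 T c b u w u≢w u∈c w∈c u∈b w∈b) y∈c

  complete-in-triangle : ∀ S → IsComplete G S → ∀ u → S u ≡ true →
                         Σ (Fin n) λ a → ∀ w → S w ≡ true → w ∈⟨ t ⟩ a
  complete-in-triangle S S-complete u Su with vertex-covered T u
  ... | (a , u∈a) with all? (λ w → S w ≟ᵇ true →-dec corner? t w a)
  ...   | yes inside = a , inside
  ...   | no outside =
    let (w , ¬inside) = ¬∀⟶∃¬ _ _ (λ w → S w ≟ᵇ true →-dec corner? t w a) outside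
        Sw = S-true ¬inside
        w∉a = λ w∈a → ¬inside (λ _ → w∈a)
        u≢w = λ e → w∉a (subst (_∈⟨ t ⟩ a) e u∈a)
        (b , u∈b , w∈b) = edge-covered T u w (S-complete u w Su Sw u≢w)
    in b , complete-through-edge S S-complete u w b Su Sw u≢w u∈b w∈b
    where
    S-true : ∀ {w} → ¬ (S w ≡ true → w ∈⟨ t ⟩ a) → S w ≡ true
    S-true {w} ¬imp with S w
    ... | true = refl
    ... | false = ⊥-elim (¬imp (λ ()))

  maximal-is-triangle : ∀ S → IsMaxClique G S → Σ (Fin n) λ a → ∀ v → triangleSet a v ≡ S v
  maximal-is-triangle S ((u , Su) , S-complete , S-maximal) =
    let (a , S⊆a) = complete-in-triangle S S-complete u Su
        S⊆a' : _⊆_ {G} S (triangleSet a)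
        S⊆a' w Sw = ∈set (S⊆a w Sw)
        a⊆S = S-maximal (triangleSet a) (proj₁ (proj₂ (triangle-maximal a))) S⊆a'
    in a , λ v → bool-ext (a⊆S v) (S⊆a' v)

  triangleSet-injective : ∀ a b → (∀ x → triangleSet a x ≡ triangleSet b x) → a ≡ b
  triangleSet-injective a b same = meet-≤1 T a b _ _ (corner₀≢corner₁ a) (zero , refl) (suc zero , refl)
    (set∈ (trans (sym (same _)) (∈set (zero , refl))))
    (set∈ (trans (sym (same _)) (∈set (suc zero , refl))))

  meetGraph-is-cliqueGraph : IsCliqueGraph G (treeOf T)
  meetGraph-is-cliqueGraph = triangleSet , triangle-maximal , triangleSet-injective ,
    (λ S m → maximal-is-triangle S m) ,
    λ a b a≢b → mk⇔
      (λ e → let (_ , s , s' , q) = meet-edge⁻ t e in t a s , ∈set (s , refl) , ∈set (s' , sym q))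
      (λ (x , p , q) → let (s , e) = set∈ p ; (s' , e') = set∈ q in
                       meet-edge t a≢b (s , s' , trans e (sym e')))

  -- Counting: triangles of G correspond to the n triangles of the tree, each
  -- listed once in increasing order.
  private
    ∈₃⇒∈ : ∀ {a x} → x ∈₃ (t a zero , t a (suc zero) , t a (suc (suc zero))) → x ∈⟨ t ⟩ a
    ∈₃⇒∈ (inj₁ e) = zero , sym e
    ∈₃⇒∈ (inj₂ (inj₁ e)) = suc zero , sym e
    ∈₃⇒∈ (inj₂ (inj₂ e)) = suc (suc zero) , sym e

    <⇒≢ᶠ : ∀ {x y : Fin (V G)} → toℕ x < toℕ y → x ≢ y
    <⇒≢ᶠ lt e = <⇒≢ lt (cong toℕ e)

  sortedCorners : ∀ a → Sorting (t a zero) (t a (suc zero)) (t a (suc (suc zero)))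
  sortedCorners a = sort3 _ _ _ (distinct (λ ())) (distinct (λ ())) (distinct (λ ()))
    where
    distinct : ∀ {s s'} → s ≢ s' → t a s ≢ t a s'
    distinct s≢s' e = s≢s' (corner-injective T a _ _ e)

  asTriangle : ∀ a → Sorting (t a zero) (t a (suc zero)) (t a (suc (suc zero))) → Triangle G
  asTriangle a (sorting i j k i<j j<k i∈ j∈ k∈ _ _ _) =
    i , j , k , isTriangle-complete G i<j j<k
      (corners-adjacent T (∈₃⇒∈ i∈) (∈₃⇒∈ j∈) (<⇒≢ᶠ i<j))
      (corners-adjacent T (∈₃⇒∈ j∈) (∈₃⇒∈ k∈) (<⇒≢ᶠ j<k))
      (corners-adjacent T (∈₃⇒∈ i∈) (∈₃⇒∈ k∈) (<⇒≢ᶠ (<-trans i<j j<k)))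

  containing : (τ : Triangle G) → let (i , j , k , _) = τ in
               ∃ λ a → i ∈⟨ t ⟩ a × j ∈⟨ t ⟩ a × k ∈⟨ t ⟩ a
  containing (i , j , k , p) =
    let (_ , _ , ij , jk , ik) = isTriangle-sound G p in triangle-covered T i j k ij jk ik

  ∈⇒∈₃ : ∀ {c x} → x ∈⟨ t ⟩ c → (S : Sorting (t c zero) (t c (suc zero)) (t c (suc (suc zero)))) →
         x ∈₃ (Sorting.i S , Sorting.j S , Sorting.k S)
  ∈⇒∈₃ (zero , refl) S = Sorting.u∈ S
  ∈⇒∈₃ (suc zero , refl) S = Sorting.v∈ S
  ∈⇒∈₃ (suc (suc zero) , refl) S = Sorting.w∈ S

  triangles↔tree : Triangle G ↔ Fin n
  triangles↔tree =
    mk↔ₛ′ (proj₁ ∘ containing) (λ a → asTriangle a (sortedCorners a)) contains-own listed-once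
    where
    contains-own : ∀ a → proj₁ (containing (asTriangle a (sortedCorners a))) ≡ a
    contains-own a with sortedCorners a
    ... | S@(sorting i j k i<j _ i∈ j∈ _ _ _ _) =
      let (_ , i∈c , j∈c , _) = containing (asTriangle a S)
      in meet-≤1 T _ a i j (<⇒≢ᶠ i<j) i∈c j∈c (∈₃⇒∈ i∈) (∈₃⇒∈ j∈)
    listed-once : ∀ τ → asTriangle (proj₁ (containing τ)) (sortedCorners (proj₁ (containing τ))) ≡ τ
    listed-once τ@(i , j , k , p) with containing τ
    ... | (c , i∈c , j∈c , k∈c) with sortedCorners c
    ... | S@(sorting i' j' k' i'<j' j'<k' _ _ _ _ _ _)
      with isTriangle-sound G {i} {j} {k} p
    ... | (i<j , j<k , _)
      with sorting-unique i<j j<k i'<j' j'<k' (∈⇒∈₃ i∈c S) (∈⇒∈₃ j∈c S) (∈⇒∈₃ k∈c S)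
    ... | refl , refl , refl = cong (λ q → i , j , k , q) (uip _ _)

  numTriangles≡ : numTriangles G ≡ n
  numTriangles≡ = ↔⇒≡ (↔-trans (↔-sym (triangles↔numTriangles G)) triangles↔tree)

-- A triangle meets each other triangle at one of its three corners, and each
-- corner is shared with at most one other triangle: the meet graph has degree ≤ 3.
meetGraph-deg≤3 : ∀ {G n} (T : TriangleTree G n) a → deg (treeOf T) a ≤ 3
meetGraph-deg≤3 {G} {n} T a = deg-≤ (treeOf T) a slot slot-injective
  where
  slot : Neighbour (treeOf T) a → Fin 3
  slot (b , e) = proj₁ (proj₂ (meet-edge⁻ (corner T) e))
  same-slot : ∀ {b b'} (m : (a ≢ b) × Meet (corner T) a b) (m' : (a ≢ b') × Meet (corner T) a b') →
              proj₁ (proj₂ m) ≡ proj₁ (proj₂ m') → b ≡ b'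
  same-slot (a≢b , s , r , q) (a≢b' , .s , r' , q') refl
    with at-most-two T (corner T a s) a _ _ (s , refl) (r , sym q) (r' , sym q')
  ... | inj₁ a≡b = ⊥-elim (a≢b a≡b)
  ... | inj₂ (inj₁ a≡b') = ⊥-elim (a≢b' a≡b')
  ... | inj₂ (inj₂ b≡b') = b≡b'
  slot-injective : ∀ {y z} → slot y ≡ slot z → y ≡ z
  slot-injective {b , e} {b' , e'} same =
    subset-≡ {P = adj (treeOf T) a} (same-slot (meet-edge⁻ (corner T) e) (meet-edge⁻ (corner T) e') same)

cliqueGraph-exists : ∀ n G → InTn n G → Σ Graph (IsCliqueGraph G)
cliqueGraph-exists n G (G∈𝒯 , _) =
  let (m , T) = triangleTree-of-𝒯 G∈𝒯 in treeOf T , CliquesOf.meetGraph-is-cliqueGraph T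

cliqueGraph-in-𝒜 : ∀ n G H → InTn n G → IsCliqueGraph G H → InA n H
cliqueGraph-in-𝒜 n G H (G∈𝒯 , G-triangles) H-clique =
  let (m , T) = triangleTree-of-𝒯 G∈𝒯
      φ : treeOf T ≅ H
      φ = cliqueGraph-unique {G} {treeOf T} {H} (CliquesOf.meetGraph-is-cliqueGraph T) H-clique
      m≡n : m ≡ n
      m≡n = trans (sym (CliquesOf.numTriangles≡ T)) G-triangles
  in trans (sym (↔⇒≡ (proj₁ φ))) m≡n ,
     tree-≅ φ (meet-tree T) ,
     λ x → subst (λ z → deg H z ≤ 3) (strictlyInverseˡ (proj₁ φ) x)
             (subst (_≤ 3) (deg-≅ {treeOf T} {H} φ (from (proj₁ φ) x)) (meetGraph-deg≤3 T _))

-- Sorting the three slots of a triangle: marked slots first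

slotPattern : Bool → Bool → Bool → Fin 3 → Bool
slotPattern b₀ b₁ b₂ zero = b₀
slotPattern b₀ b₁ b₂ (suc zero) = b₁
slotPattern b₀ b₁ b₂ (suc (suc zero)) = b₂

#marked : Bool → Bool → Bool → ℕ
#marked b₀ b₁ b₂ = count 3 (λ s → if slotPattern b₀ b₁ b₂ s then 1 else 0)

-- A permutation (a transposition or the identity) moving the marked slots to the front.
sortSlots : Bool → Bool → Bool → Permutation 3 3
sortSlots true false true = transpose (suc zero) (suc (suc zero))
sortSlots false true true = transpose zero (suc (suc zero))
sortSlots false true false = transpose zero (suc zero)
sortSlots false false true = transpose zero (suc (suc zero))
sortSlots _ _ _ = idₚ

sortSlots-sorted : ∀ b₀ b₁ b₂ →
  tabulate (slotPattern b₀ b₁ b₂ ∘ to (sortSlots b₀ b₁ b₂)) ≡ tabulate (λ i → toℕ i <ᵇ #marked b₀ b₁ b₂)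
sortSlots-sorted true true true = refl
sortSlots-sorted true true false = refl
sortSlots-sorted true false true = refl
sortSlots-sorted true false false = refl
sortSlots-sorted false true true = refl
sortSlots-sorted false true false = refl
sortSlots-sorted false false true = refl
sortSlots-sorted false false false = refl

sortSlots-marked : ∀ b₀ b₁ b₂ i →
  slotPattern b₀ b₁ b₂ (to (sortSlots b₀ b₁ b₂) i) ≡ (toℕ i <ᵇ #marked b₀ b₁ b₂)
sortSlots-marked b₀ b₁ b₂ i =
  trans (sym (lookup∘tabulate (slotPattern b₀ b₁ b₂ ∘ to (sortSlots b₀ b₁ b₂)) i))
        (trans (cong (λ v → lookup v i) (sortSlots-sorted b₀ b₁ b₂))
               (lookup∘tabulate (λ j → toℕ j <ᵇ #marked b₀ b₁ b₂) i))

-- Shared and private corners of a triangle tree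

module SharedCorners {G : Graph} {n : ℕ} (T : TriangleTree G n) where

  private
    t : Corners (V G) n
    t = corner T

  Shared : Fin n → Fin 3 → Set
  Shared a s = ∃ λ b → b ≢ a × t a s ∈⟨ t ⟩ b

  opaque
    shared? : ∀ a s → Dec (Shared a s)
    shared? a s = any? λ b → ¬? (b ≟ᶠ a) ×-dec corner? t (t a s) b

  shared : Fin n → Fin 3 → Bool
  shared a s = does (shared? a s)

  order : Fin n → Permutation 3 3
  order a = sortSlots (shared a zero) (shared a (suc zero)) (shared a (suc (suc zero)))

  #shared : Fin n → ℕ
  #shared a = #marked (shared a zero) (shared a (suc zero)) (shared a (suc (suc zero)))

  order-shared : ∀ a i → shared a (to (order a) i) ≡ (toℕ i <ᵇ #shared a)
  order-shared a i = trans (as-pattern (to (order a) i))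
    (sortSlots-marked (shared a zero) (shared a (suc zero)) (shared a (suc (suc zero))) i)
    where
    as-pattern : ∀ s →
      shared a s ≡ slotPattern (shared a zero) (shared a (suc zero)) (shared a (suc (suc zero))) s
    as-pattern zero = refl
    as-pattern (suc zero) = refl
    as-pattern (suc (suc zero)) = refl

  private-corner : ∀ a s → shared a s ≡ false → ∀ c → t a s ∈⟨ t ⟩ c → c ≡ a
  private-corner a s unshared c t∈c with c ≟ᶠ a
  ... | yes c≡a = c≡a
  ... | no c≢a with trans (sym (dec-true (shared? a s) (c , c≢a , t∈c))) unshared
  ... | ()

  shared-sound : ∀ a s → shared a s ≡ true → Shared a s
  shared-sound a s = does-sound (shared? a s)

  shared↔neighbours : ∀ a → Σ (Fin 3) (λ s → shared a s ≡ true) ↔ Neighbour (treeOf T) a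
  shared↔neighbours a = mk↔ₛ′ forth back forth-back back-forth
    where
    forth : Σ (Fin 3) (λ s → shared a s ≡ true) → Neighbour (treeOf T) a
    forth (s , e) = let (b , b≢a , (s' , q)) = shared-sound a s e in
      b , meet-edge t (b≢a ∘ sym) (s , s' , sym q)
    back : Neighbour (treeOf T) a → Σ (Fin 3) (λ s → shared a s ≡ true)
    back (b , e) = let (a≢b , s , s' , q) = meet-edge⁻ t e in
      s , dec-true (shared? a s) (b , a≢b ∘ sym , s' , sym q)
    partner-unique : ∀ b s → a ≢ b → t a s ∈⟨ t ⟩ b → (p : shared a s ≡ true) →
                     proj₁ (shared-sound a s p) ≡ b
    partner-unique b s a≢b t∈b p with shared-sound a s p
    ... | (b' , b'≢a , t∈b') with at-most-two T (t a s) a b b' (s , refl) t∈b t∈b'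
    ...   | inj₁ a≡b = ⊥-elim (a≢b a≡b)
    ...   | inj₂ (inj₁ a≡b') = ⊥-elim (b'≢a (sym a≡b'))
    ...   | inj₂ (inj₂ b≡b') = sym b≡b'
    slot-unique : ∀ s b → b ≢ a → t a s ∈⟨ t ⟩ b → (m : (a ≢ b) × Meet t a b) → proj₁ (proj₂ m) ≡ s
    slot-unique s b b≢a t∈b (_ , s' , r , q) with s' ≟ᶠ s
    ... | yes s'≡s = s'≡s
    ... | no s'≢s = ⊥-elim (b≢a (meet-≤1 T b a (t a s') (t a s) (s'≢s ∘ corner-injective T a _ _)
                      (r , sym q) t∈b (s' , refl) (s , refl)))
    forth-back : ∀ y → forth (back y) ≡ y
    forth-back (b , e) = let (a≢b , s , s' , q) = meet-edge⁻ t e in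
      subset-≡ {P = adj (treeOf T) a} (partner-unique b s a≢b (s' , sym q) _)
    back-forth : ∀ x → back (forth x) ≡ x
    back-forth (s , p) = let (b , b≢a , t∈b) = shared-sound a s p in
      subset-≡ {P = shared a} (slot-unique s b b≢a t∈b (meet-edge⁻ t _))

  #shared≡deg : ∀ a → #shared a ≡ deg (treeOf T) a
  #shared≡deg a = ↔⇒≡ (↔-trans (↔-sym (count-true 3 (shared a)))
                          (↔-trans (shared↔neighbours a) (neighbours↔deg (treeOf T) a)))

-- Lifting an isomorphism of meet graphs to the underlying graphs

-- A vertex map compatible with a bijection f of triangles: corners of c go to
-- corners of f c, and private corners are matched in sorted slot order.
record CornerMap {G G' : Graph} {n : ℕ} (T : TriangleTree G n) (T' : TriangleTree G' n)
                 (f : Fin n ↔ Fin n) : Set where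
  private
    module S = SharedCorners T
    module S' = SharedCorners T'
  field
    vmap : Fin (V G) → Fin (V G')
    vmap-∈ : ∀ v c → v ∈⟨ corner T ⟩ c → vmap v ∈⟨ corner T' ⟩ to f c
    vmap-private : ∀ a i → S.shared a (to (S.order a) i) ≡ false →
                   vmap (corner T a (to (S.order a) i)) ≡ corner T' (to f a) (to (S'.order (to f a)) i)
open CornerMap public

-- A shared corner of a
-- (also in b) goes to the common corner of φ a and φ b; a private corner goes
-- to the private corner of φ a in the same sorted position.
module _ {G G' : Graph} {n : ℕ} (T : TriangleTree G n) (T' : TriangleTree G' n)
         (φ : treeOf T ≅ treeOf T') where
  private
    module S = SharedCorners T
    module S' = SharedCorners T'
    t : Corners (V G) n
    t = corner T
    t' : Corners (V G') n
    t' = corner T'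
    f : Fin n ↔ Fin n
    f = proj₁ φ

    image-meet : ∀ {a b} → a ≢ b → Meet t a b → (to f a ≢ to f b) × Meet t' (to f a) (to f b)
    image-meet {a} {b} a≢b m = meet-edge⁻ t' (≅-edge {treeOf T} {treeOf T'} φ (meet-edge t a≢b m))

    common : ∀ {a b} → a ≢ b → Meet t a b → Fin (V G')
    common {a} a≢b m = t' (to f a) (proj₁ (proj₂ (image-meet a≢b m)))

    common-∈ : ∀ {a b} (a≢b : a ≢ b) m → common a≢b m ∈⟨ t' ⟩ to f a × common a≢b m ∈⟨ t' ⟩ to f b
    common-∈ a≢b m = let (_ , s , s' , q) = image-meet a≢b m in (s , refl) , (s' , sym q)

    image : ∀ a s → Dec (S.Shared a s) → Fin (V G')
    image a s (yes (b , b≢a , s' , q)) = common (b≢a ∘ sym) (s , s' , sym q)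
    image a s (no _) = t' (to f a) (to (S'.order (to f a)) (from (S.order a) s))

    ψ : Fin (V G) → Fin (V G')
    ψ v = let (a , s , _) = vertex-covered T v in image a s (S.shared? a s)

    image-∈ : ∀ a s (d : Dec (S.Shared a s)) c → t a s ∈⟨ t ⟩ c → image a s d ∈⟨ t' ⟩ to f c
    image-∈ a s (yes (b , b≢a , s' , q)) c t∈c with at-most-two T (t a s) a b c (s , refl) (s' , q) t∈c
    ... | inj₁ a≡b = ⊥-elim (b≢a (sym a≡b))
    ... | inj₂ (inj₁ refl) = proj₁ (common-∈ (b≢a ∘ sym) (s , s' , sym q))
    ... | inj₂ (inj₂ refl) = proj₂ (common-∈ (b≢a ∘ sym) (s , s' , sym q))
    image-∈ a s (no unshared) c t∈c with c ≟ᶠ a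
    ... | yes refl = _ , refl
    ... | no c≢a = ⊥-elim (unshared (c , c≢a , t∈c))

    ψ-∈ : ∀ v c → v ∈⟨ t ⟩ c → ψ v ∈⟨ t' ⟩ to f c
    ψ-∈ v c v∈c with vertex-covered T v
    ... | (a , s , refl) = image-∈ a s (S.shared? a s) c v∈c

    ψ-private : ∀ a i → S.shared a (to (S.order a) i) ≡ false →
                ψ (t a (to (S.order a) i)) ≡ t' (to f a) (to (S'.order (to f a)) i)
    ψ-private a i unshared with vertex-covered T (t a (to (S.order a) i))
    ... | (a' , s' , e) with S.private-corner a _ unshared a' (s' , e)
    ... | refl with corner-injective T a _ _ e
    ... | refl with S.shared? a (to (S.order a) i)
    ... | yes _ = case unshared of λ ()
    ... | no _ = cong (λ z → t' (to f a) (to (S'.order (to f a)) z)) (strictlyInverseʳ (S.order a) i)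

  induced-cornerMap : CornerMap T T' f
  induced-cornerMap = record { vmap = ψ ; vmap-∈ = ψ-∈ ; vmap-private = ψ-private }

  #shared-≅ : ∀ a → S.#shared a ≡ S'.#shared (to f a)
  #shared-≅ a =
    trans (S.#shared≡deg a) (trans (deg-≅ {treeOf T} {treeOf T'} φ a) (sym (S'.#shared≡deg (to f a))))

module _ {G G' : Graph} {n : ℕ} {T : TriangleTree G n} {T' : TriangleTree G' n} {f : Fin n ↔ Fin n}
         (ψ : CornerMap T T' f) (ψ' : CornerMap T' T (↔-sym f))
         (#shared-same : ∀ a → SharedCorners.#shared T a ≡ SharedCorners.#shared T' (to f a)) where
  private
    module S = SharedCorners T
    module S' = SharedCorners T'

    round-trip : Fin (V G) → Fin (V G)
    round-trip = vmap ψ' ∘ vmap ψ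

    round-trip-∈ : ∀ v c → v ∈⟨ corner T ⟩ c → round-trip v ∈⟨ corner T ⟩ c
    round-trip-∈ v c v∈c =
      subst (round-trip v ∈⟨ corner T ⟩_) (strictlyInverseʳ f c) (vmap-∈ ψ' _ _ (vmap-∈ ψ v c v∈c))

    -- A shared corner is the only vertex common to its two triangles.
    shared-returns : ∀ a s b → b ≢ a → corner T a s ∈⟨ corner T ⟩ b →
                     round-trip (corner T a s) ≡ corner T a s
    shared-returns a s b b≢a x∈b with round-trip (corner T a s) ≟ᶠ corner T a s
    ... | yes e = e
    ... | no moved = ⊥-elim (b≢a (sym (meet-≤1 T a b _ _ moved
            (round-trip-∈ _ a (s , refl)) (s , refl) (round-trip-∈ _ b x∈b) x∈b)))

    -- A private corner returns to the same sorted position of the same triangle.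
    private-returns : ∀ a s → ¬ S.Shared a s → round-trip (corner T a s) ≡ corner T a s
    private-returns a s unshared = begin
      round-trip (corner T a s)                                     ≡⟨ cong (round-trip ∘ corner T a) (sym at-i) ⟩
      vmap ψ' (vmap ψ (corner T a (to (S.order a) i)))              ≡⟨ cong (vmap ψ') (vmap-private ψ a i unshared-i) ⟩
      vmap ψ' (corner T' (to f a) (to (S'.order (to f a)) i))       ≡⟨ vmap-private ψ' (to f a) i unshared-i' ⟩
      corner T (from f (to f a)) (to (S.order (from f (to f a))) i) ≡⟨ cong (λ c → corner T c (to (S.order c) i))
                                                                          (strictlyInverseʳ f a) ⟩
      corner T a (to (S.order a) i)                                 ≡⟨ cong (corner T a) at-i ⟩
      corner T a s                                                  ∎
      where
      open ≡-Reasoning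
      i : Fin 3
      i = from (S.order a) s
      at-i : to (S.order a) i ≡ s
      at-i = strictlyInverseˡ (S.order a) s
      unshared-i : S.shared a (to (S.order a) i) ≡ false
      unshared-i = trans (cong (S.shared a) at-i) (dec-false (S.shared? a s) unshared)
      -- Sorted position i is private in f a too, as both have #shared below i.
      unshared-i' : S'.shared (to f a) (to (S'.order (to f a)) i) ≡ false
      unshared-i' = trans (S'.order-shared (to f a) i)
        (trans (cong (toℕ i <ᵇ_) (sym (#shared-same a))) (trans (sym (S.order-shared a i)) unshared-i))

  cornerMap-inverse : ∀ v → vmap ψ' (vmap ψ v) ≡ v
  cornerMap-inverse v with vertex-covered T v
  ... | (a , s , refl) with S.shared? a s
  ... | yes (b , b≢a , x∈b) = shared-returns a s b b≢a x∈b
  ... | no unshared = private-returns a s unshared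

lift-≅ : ∀ {G G' n} (T : TriangleTree G n) (T' : TriangleTree G' n) → treeOf T ≅ treeOf T' → G ≅ G'
lift-≅ {G} {G'} {n} T T' φ = mk↔ₛ′ (vmap ψ) (vmap ψ') there-and-back back-and-there , adjacency
  where
  f : Fin n ↔ Fin n
  f = proj₁ φ
  ψ : CornerMap T T' f
  ψ = induced-cornerMap T T' φ
  ψ' : CornerMap T' T (↔-sym f)
  ψ' = induced-cornerMap T' T (≅-sym {treeOf T} {treeOf T'} φ)
  back-and-there : ∀ v → vmap ψ' (vmap ψ v) ≡ v
  back-and-there = cornerMap-inverse ψ ψ' (#shared-≅ T T' φ)
  there-and-back : ∀ w → vmap ψ (vmap ψ' w) ≡ w
  there-and-back = cornerMap-inverse ψ' ψ λ b →
    trans (cong (SharedCorners.#shared T') (sym (strictlyInverseˡ f b))) (sym (#shared-≅ T T' φ (from f b)))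
  -- Both graphs are the union of their triangles, and ψ maps triangles to triangles.
  adjacency : ∀ u v → adj G u v ≡ adj G' (vmap ψ u) (vmap ψ v)
  adjacency u v = bool-ext
    (λ e → let (c , u∈c , v∈c) = edge-covered T u v e in
           corners-adjacent T' (vmap-∈ ψ u c u∈c) (vmap-∈ ψ v c v∈c)
             (λ same → loop-free G e
                (trans (sym (back-and-there u)) (trans (cong (vmap ψ') same) (back-and-there v)))))
    (λ e → let (c , u∈c , v∈c) = edge-covered T' _ _ e
               u∈ = subst (_∈⟨ corner T ⟩ from f c) (back-and-there u) (vmap-∈ ψ' _ c u∈c)
               v∈ = subst (_∈⟨ corner T ⟩ from f c) (back-and-there v) (vmap-∈ ψ' _ c v∈c)
           in corners-adjacent T u∈ v∈ (λ u≡v → loop-free G' e (cong (vmap ψ) u≡v)))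

cliqueGraph-injective : ∀ n G G' H H' → InTn n G → InTn n G' → IsCliqueGraph G H → IsCliqueGraph G' H' →
                        H ≅ H' → G ≅ G'
cliqueGraph-injective n G G' H H' (G∈𝒯 , G-triangles) (G'∈𝒯 , G'-triangles) H-clique H'-clique H≅H' =
  let (m , T) = triangleTree-of-𝒯 G∈𝒯
      (m' , T') = triangleTree-of-𝒯 G'∈𝒯
  in through-clique-graphs T T'
       (trans (sym (CliquesOf.numTriangles≡ T))
              (trans G-triangles (trans (sym G'-triangles) (CliquesOf.numTriangles≡ T'))))
       (cliqueGraph-unique {G} {treeOf T} {H} (CliquesOf.meetGraph-is-cliqueGraph T) H-clique)
       (cliqueGraph-unique {G'} {treeOf T'} {H'} (CliquesOf.meetGraph-is-cliqueGraph T') H'-clique)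
  where
  through-clique-graphs : ∀ {m m'} (T : TriangleTree G m) (T' : TriangleTree G' m') → m ≡ m' →
                          treeOf T ≅ H → treeOf T' ≅ H' → G ≅ G'
  through-clique-graphs T T' refl φ φ' =
    lift-≅ T T' (≅-trans {treeOf T} {H} {treeOf T'} φ
                  (≅-trans {H} {H'} {treeOf T'} H≅H' (≅-sym {treeOf T'} {H'} φ')))

-- Trees with at least two vertices have a leaf

least : (Q : ℕ → Set) → (∀ j → Dec (Q j)) → ∀ j₀ → Q j₀ → Σ ℕ λ j → Q j × (∀ j' → j' < j → ¬ Q j')
least Q Q? j₀ q₀ = [ id , (λ none → ⊥-elim (none j₀ ≤-refl q₀)) ] (search (suc j₀))
  where
  search : ∀ k → (Σ ℕ λ j → Q j × (∀ j' → j' < j → ¬ Q j')) ⊎ (∀ j' → j' < k → ¬ Q j')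
  search zero = inj₂ (λ _ ())
  search (suc k) with search k
  ... | inj₁ found = inj₁ found
  ... | inj₂ none with Q? k
  ...   | yes q = inj₁ (k , q , none)
  ...   | no ¬q = inj₂ λ j' j'<1+k → [ none j' , (λ { refl → ¬q }) ] (m≤n⇒m<n∨m≡n (s≤s⁻¹ j'<1+k))

module LeafOfTree (H : Graph) (H-tree : IsTree H) (x₀ y₀ : Fin (V H)) (x₀≢y₀ : x₀ ≢ y₀) where

  first-step : ∀ {x y} → Walk H x y → x ≢ y → Σ (Fin (V H)) λ z → adj H x z ≡ true
  first-step (here _) x≢y = ⊥-elim (x≢y refl)
  first-step (there e _) _ = _ , e

  has-neighbour : ∀ x → Σ (Fin (V H)) λ z → adj H x z ≡ true
  has-neighbour x with x ≟ᶠ x₀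
  ... | yes refl = first-step (proj₁ H-tree x₀ y₀) x₀≢y₀
  ... | no x≢x₀ = first-step (proj₁ H-tree x x₀) x≢x₀

  deg≥1 : ∀ x → 1 ≤ deg H x
  deg≥1 x = let (z , e) = has-neighbour x in deg-≥ H x (λ _ → z) (λ { {zero} {zero} _ → refl }) (λ _ → e)

  two-neighbours : ∀ x → 2 ≤ deg H x → Σ (Fin (V H)) λ a → Σ (Fin (V H)) λ b →
                   a ≢ b × adj H x a ≡ true × adj H x b ≡ true
  two-neighbours x 2≤deg =
    let (a , ea) = from (neighbours↔deg H x) first
        (b , eb) = from (neighbours↔deg H x) second
        a≢b = λ a≡b → first≢second (↔-injective (↔-sym (neighbours↔deg H x)) (subset-≡ {P = adj H x} a≡b))
    in a , b , a≢b , ea , eb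
    where
    first second : Fin (deg H x)
    first = fromℕ< {0} {deg H x} (≤-trans (s≤s z≤n) 2≤deg)
    second = fromℕ< {1} {deg H x} 2≤deg
    first≢second : first ≢ second
    first≢second e with trans (sym (toℕ-fromℕ< (≤-trans (s≤s z≤n) 2≤deg)))
                              (trans (cong toℕ e) (toℕ-fromℕ< 2≤deg))
    ... | ()

  -- If every vertex had degree ≥ 2, a walk that never turns back would
  -- eventually repeat a vertex; the segment up to its first repetition is a cycle.
  module NoLeaf (deg≥2 : ∀ x → 2 ≤ deg H x) where

    onward : ∀ (p c : Fin (V H)) → Σ (Fin (V H)) λ z → adj H c z ≡ true × z ≢ p
    onward p c with two-neighbours c (deg≥2 c)
    ... | (a , b , a≢b , ea , eb) with a ≟ᶠ p
    ...   | yes refl = b , eb , a≢b ∘ sym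
    ...   | no a≢p = a , ea , a≢p

    -- Consecutive pairs (u t , u (t+1)) of a non-backtracking walk from x₀.
    steps : ℕ → Fin (V H) × Fin (V H)
    steps zero = x₀ , proj₁ (has-neighbour x₀)
    steps (suc t) = proj₂ (steps t) , proj₁ (onward (proj₁ (steps t)) (proj₂ (steps t)))

    u : ℕ → Fin (V H)
    u t = proj₁ (steps t)

    u-adjacent : ∀ t → adj H (u t) (u (suc t)) ≡ true
    u-adjacent zero = proj₂ (has-neighbour x₀)
    u-adjacent (suc t) = proj₁ (proj₂ (onward (proj₁ (steps t)) (proj₂ (steps t))))

    u-no-return : ∀ t → u (suc (suc t)) ≢ u t
    u-no-return t = proj₂ (proj₂ (onward (proj₁ (steps t)) (proj₂ (steps t))))

    Repeats : ℕ → Set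
    Repeats j = Σ (Fin j) λ i → u (toℕ i) ≡ u j

    some-repeat : Σ ℕ Repeats
    some-repeat = let (r₁ , r₂ , r₁<r₂ , e) = pigeonhole (n<1+n (V H)) (λ r → u (toℕ r))
                  in toℕ r₂ , fromℕ< r₁<r₂ , trans (cong u (toℕ-fromℕ< r₁<r₂)) e

    contradiction : ⊥
    contradiction
      with least Repeats (λ j → any? λ i → u (toℕ i) ≟ᶠ u j) (proj₁ some-repeat) (proj₂ some-repeat)
    ... | (j , (i , uᵢ≡uⱼ) , earlier) = closes (toℕ i) uᵢ≡uⱼ (gap (toℕ<n i))
      where
      distinct-before-j : ∀ a b → a < b → b < j → u a ≢ u b
      distinct-before-j a b a<b b<j e = earlier b b<j (fromℕ< a<b , trans (cong u (toℕ-fromℕ< a<b)) e)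
      gap : ∀ {i j} → i < j → Σ ℕ λ d → j ≡ suc (i + d)
      gap {i} {j} i<j = j ∸ suc i , sym (m+[n∸m]≡n i<j)
      closes : ∀ i → u i ≡ u j → (Σ ℕ λ d → j ≡ suc (i + d)) → ⊥
      closes i e (zero , refl) =
        loop-free H (u-adjacent i) (trans e (cong u (cong suc (+-identityʳ i))))
      closes i e (suc zero , refl) =
        u-no-return i (sym (trans e (cong u (cong suc (trans (+-suc i 0) (cong suc (+-identityʳ i)))))))
      closes i e (suc (suc k) , refl) = proj₂ H-tree (k , c , c-injective , c-step , c-close)
        where
        c : Fin (suc (suc (suc k))) → Fin (V H)
        c r = u (i + toℕ r)
        in-range : ∀ (r : Fin (suc (suc (suc k)))) → i + toℕ r < suc (i + suc (suc k))
        in-range r = subst (i + toℕ r <_) (+-suc i (suc (suc k))) (+-monoʳ-< i (toℕ<n r))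
        c-injective : ∀ {r r'} → c r ≡ c r' → r ≡ r'
        c-injective {r} {r'} e' with <-cmp (toℕ r) (toℕ r')
        ... | tri< lt _ _ = ⊥-elim (distinct-before-j _ _ (+-monoʳ-< i lt) (in-range r') e')
        ... | tri≈ _ eq _ = toℕ-injective eq
        ... | tri> _ _ gt = ⊥-elim (distinct-before-j _ _ (+-monoʳ-< i gt) (in-range r) (sym e'))
        c-step : ∀ (r : Fin (suc (suc k))) → adj H (c (inject₁ r)) (c (suc r)) ≡ true
        c-step r = subst₂ (λ p q → adj H (u p) (u q) ≡ true)
                     (cong (i +_) (sym (toℕ-inject₁ r))) (sym (+-suc i (toℕ r))) (u-adjacent (i + toℕ r))
        c-close : adj H (c (fromℕ (suc (suc k)))) (c zero) ≡ true
        c-close = subst₂ (λ p q → adj H (u p) q ≡ true)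
                    (cong (i +_) (sym (toℕ-fromℕ (suc (suc k)))))
                    (trans (sym e) (cong u (sym (+-identityʳ i))))
                    (u-adjacent (i + suc (suc k)))

  leaf : Σ (Fin (V H)) λ ℓ → deg H ℓ ≡ 1
  leaf with any? (λ ℓ → deg H ℓ ≟ 1)
  ... | yes found = found
  ... | no none = ⊥-elim (NoLeaf.contradiction deg≥2)
    where
    deg≥2 : ∀ x → 2 ≤ deg H x
    deg≥2 x with deg H x | deg≥1 x | (λ (e : deg H x ≡ 1) → none (x , e))
    ... | suc zero | _ | not-leaf = ⊥-elim (not-leaf refl)
    ... | suc (suc d) | _ | _ = s≤s (s≤s z≤n)

-- Removing a leaf from a tree

relabel : ∀ {N} (H : Graph) → V H ≡ N → Graph
relabel {N} H e = record
  { V = N ; adj = λ i j → adj H (cast i) (cast j)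
  ; sym = λ i j → Graph.sym H (cast i) (cast j) ; irr = λ i → irr H (cast i) }
  where
  cast : Fin N → Fin (V H)
  cast = subst Fin (sym e)

relabel-≅ : ∀ {N} (H : Graph) (e : V H ≡ N) → relabel H e ≅ H
relabel-≅ H refl = ↔-refl , λ x y → refl

module Remove {k : ℕ} (H : Graph) (e : V H ≡ suc k) (ℓ : Fin (suc k)) where

  H₁ : Graph
  H₁ = relabel H e

  H₀ : Graph
  H₀ = record
    { V = k ; adj = λ i j → adj H₁ (punchIn ℓ i) (punchIn ℓ j)
    ; sym = λ i j → Graph.sym H₁ _ _ ; irr = λ i → irr H₁ _ }

  acyclic₀ : ¬ HasCycle H₁ → ¬ HasCycle H₀
  acyclic₀ acyclic (k' , c , c-inj , c-step , c-close) =
    acyclic (k' , punchIn ℓ ∘ c , (λ e → c-inj (punchIn-injective ℓ _ _ e)) , c-step , c-close)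

  deg₀≤ : ∀ i → deg H₀ i ≤ deg H₁ (punchIn ℓ i)
  deg₀≤ i = deg-≥ H₁ (punchIn ℓ i) (punchIn ℓ ∘ proj₁ ∘ from (neighbours↔deg H₀ i))
    (λ e → ↔-injective (↔-sym (neighbours↔deg H₀ i)) (subset-≡ {P = adj H₀ i} (punchIn-injective ℓ _ _ e)))
    (proj₂ ∘ from (neighbours↔deg H₀ i))

  module Leaf (p : Fin (suc k)) (ℓ-p : adj H₁ ℓ p ≡ true) (only-p : ∀ z → adj H₁ ℓ z ≡ true → z ≡ p) where

    ℓ≢p : ℓ ≢ p
    ℓ≢p = loop-free H₁ ℓ-p

    p₀ : Fin k
    p₀ = punchOut ℓ≢p

    punchIn-p₀ : punchIn ℓ p₀ ≡ p
    punchIn-p₀ = punchIn-punchOut ℓ≢p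

    -- A walk avoiding ℓ at its ends can be shortcut to avoid ℓ entirely: it can
    -- only enter ℓ from p and must leave back to p.
    avoid : ∀ {u v} → Walk H₁ u v → (ℓ≢u : ℓ ≢ u) → (ℓ≢v : ℓ ≢ v) → Walk H₀ (punchOut ℓ≢u) (punchOut ℓ≢v)
    avoid (here u) ℓ≢u ℓ≢v = subst (Walk H₀ (punchOut ℓ≢u)) (punchOut-cong ℓ refl) (here _)
    avoid (there {u} {z} e w) ℓ≢u ℓ≢v with ℓ ≟ᶠ z
    ... | no ℓ≢z =
      there (subst₂ (λ a b → adj H₁ a b ≡ true) (sym (punchIn-punchOut ℓ≢u)) (sym (punchIn-punchOut ℓ≢z)) e)
            (avoid w ℓ≢z ℓ≢v)
    avoid (there e (here _)) ℓ≢u ℓ≢v | yes refl = ⊥-elim (ℓ≢v refl)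
    avoid (there {u} e (there {_} {z₂} e₂ w₂)) ℓ≢u ℓ≢v | yes refl =
      let z₂≡u = trans (only-p z₂ e₂) (sym (only-p u (trans (Graph.sym H₁ ℓ u) e)))
      in subst (λ a → Walk H₀ a (punchOut ℓ≢v)) (punchOut-cong ℓ z₂≡u)
               (avoid w₂ (λ q → ℓ≢u (trans q z₂≡u)) ℓ≢v)

    connected₀ : Connected H₁ → Connected H₀
    connected₀ connected i j = subst₂ (Walk H₀) (punchOut-punchIn ℓ) (punchOut-punchIn ℓ)
      (avoid (connected (punchIn ℓ i) (punchIn ℓ j)) (punchInᵢ≢i ℓ i ∘ sym) (punchInᵢ≢i ℓ j ∘ sym))

    deg-p₀ : suc (deg H₀ p₀) ≤ deg H₁ p
    deg-p₀ = subst (λ z → suc (deg H₀ p₀) ≤ deg H₁ z) punchIn-p₀ (deg-≥ H₁ (punchIn ℓ p₀) h h-inj h-adj)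
      where
      h : Fin (suc (deg H₀ p₀)) → Fin (suc k)
      h zero = ℓ
      h (suc r) = punchIn ℓ (proj₁ (from (neighbours↔deg H₀ p₀) r))
      h-inj : ∀ {r r'} → h r ≡ h r' → r ≡ r'
      h-inj {zero} {zero} _ = refl
      h-inj {zero} {suc r'} e = ⊥-elim (punchInᵢ≢i ℓ _ (sym e))
      h-inj {suc r} {zero} e = ⊥-elim (punchInᵢ≢i ℓ _ e)
      h-inj {suc r} {suc r'} e =
        cong suc (↔-injective (↔-sym (neighbours↔deg H₀ p₀))
                              (subset-≡ {P = adj H₀ p₀} (punchIn-injective ℓ _ _ e)))
      h-adj : ∀ r → adj H₁ (punchIn ℓ p₀) (h r) ≡ true
      h-adj zero = trans (Graph.sym H₁ _ ℓ) (subst (λ z → adj H₁ ℓ z ≡ true) (sym punchIn-p₀) ℓ-p)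
      h-adj (suc r) = proj₂ (from (neighbours↔deg H₀ p₀) r)

-- Every tree of maximum degree ≤ 3 is a meet graph

Realisation : ℕ → Graph → Set
Realisation n H = Σ Graph λ G → InT G × Σ (TriangleTree G n) λ T → treeOf T ≅ H

leaf-neighbour-unique : ∀ (H : Graph) {ℓ p} → deg H ℓ ≡ 1 → adj H ℓ p ≡ true → ∀ z → adj H ℓ z ≡ true → z ≡ p
leaf-neighbour-unique H {ℓ} {p} deg≡1 ℓ-p z ℓ-z with z ≟ᶠ p
... | yes z≡p = z≡p
... | no z≢p with subst (2 ≤_) deg≡1 (deg-≥ H ℓ (pair p z) (pair-injective (z≢p ∘ sym)) adjacent)
  where
  adjacent : ∀ i → adj H ℓ (pair p z i) ≡ true
  adjacent zero = ℓ-p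
  adjacent (suc zero) = ℓ-z
... | s≤s ()

-- Re-attaching the leaf ℓ (with neighbour p) to a realisation of H − ℓ:
-- the triangle of p has a private corner x (p has degree ≤ 2 in H − ℓ), and
-- attaching a triangle at x realises H.
module Grow {k : ℕ} (H : Graph) (e : V H ≡ suc (suc k)) (deg≤3 : ∀ x → deg (relabel H e) x ≤ 3)
            (ℓ p : Fin (suc (suc k))) (ℓ-p : adj (relabel H e) ℓ p ≡ true)
            (only-p : ∀ z → adj (relabel H e) ℓ z ≡ true → z ≡ p)
            (rec : Realisation (suc k) (Remove.H₀ H e ℓ)) where

  open Remove H e ℓ
  open Leaf p ℓ-p only-p

  G₀ : Graph
  G₀ = proj₁ rec
  T₀ : TriangleTree G₀ (suc k)
  T₀ = proj₁ (proj₂ (proj₂ rec))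
  ι₀ : treeOf T₀ ≅ H₀
  ι₀ = proj₂ (proj₂ (proj₂ rec))
  f₀ : Fin (suc k) ↔ Fin (suc k)
  f₀ = proj₁ ι₀
  module S₀ = SharedCorners T₀

  a₀ : Fin (suc k)
  a₀ = from f₀ p₀

  #shared-a₀≤2 : S₀.#shared a₀ ≤ 2
  #shared-a₀≤2 = subst (_≤ 2)
    (sym (trans (S₀.#shared≡deg a₀)
                (trans (deg-≅ {treeOf T₀} {H₀} ι₀ a₀) (cong (deg H₀) (strictlyInverseˡ f₀ p₀)))))
    (s≤s⁻¹ (≤-trans deg-p₀ (deg≤3 p)))

  s₀ : Fin 3
  s₀ = to (S₀.order a₀) (suc (suc zero))

  s₀-private : S₀.shared a₀ s₀ ≡ false
  s₀-private = trans (S₀.order-shared a₀ (suc (suc zero))) (2≮ (S₀.#shared a₀) #shared-a₀≤2)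
    where
    2≮ : ∀ d → d ≤ 2 → (2 <ᵇ d) ≡ false
    2≮ zero _ = refl
    2≮ (suc zero) _ = refl
    2≮ (suc (suc zero)) _ = refl
    2≮ (suc (suc (suc d))) (s≤s (s≤s ()))

  x : Fin (V G₀)
  x = corner T₀ a₀ s₀

  only-a₀ : ∀ c → x ∈⟨ corner T₀ ⟩ c → c ≡ a₀
  only-a₀ = S₀.private-corner a₀ s₀ s₀-private

  module A = Attach G₀ (suc k) T₀ x a₀ (s₀ , refl) only-a₀

  G∈𝒯 : InT (attach G₀ x)
  G∈𝒯 = step (proj₁ (proj₂ rec)) x (one-triangle⇒deg2 T₀ a₀ s₀ only-a₀) (≅-refl (attach G₀ x))

  χ : Fin (suc (suc k)) → Fin (suc (suc k))
  χ zero = ℓ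
  χ (suc a) = punchIn ℓ (to f₀ a)

  χ⁻ : Fin (suc (suc k)) → Fin (suc (suc k))
  χ⁻ v with ℓ ≟ᶠ v
  ... | yes _ = zero
  ... | no ℓ≢v = suc (from f₀ (punchOut ℓ≢v))

  χχ⁻ : ∀ v → χ (χ⁻ v) ≡ v
  χχ⁻ v with ℓ ≟ᶠ v
  ... | yes ℓ≡v = ℓ≡v
  ... | no ℓ≢v = trans (cong (punchIn ℓ) (strictlyInverseˡ f₀ _)) (punchIn-punchOut ℓ≢v)

  χ⁻χ : ∀ a → χ⁻ (χ a) ≡ a
  χ⁻χ zero with ℓ ≟ᶠ ℓ
  ... | yes _ = refl
  ... | no ℓ≢ℓ = ⊥-elim (ℓ≢ℓ refl)
  χ⁻χ (suc a) with ℓ ≟ᶠ punchIn ℓ (to f₀ a)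
  ... | yes e = ⊥-elim (punchInᵢ≢i ℓ _ (sym e))
  ... | no ℓ≢ = cong suc (trans (cong (from f₀) (trans (punchOut-cong ℓ refl) (punchOut-punchIn ℓ)))
                                (strictlyInverseʳ f₀ a))

  -- The new triangle meets exactly a₀, as ℓ is adjacent exactly to p.
  new-adjacency : ∀ b → adj (treeOf A.extended) zero (suc b) ≡ adj H₁ ℓ (punchIn ℓ (to f₀ b))
  new-adjacency b = bool-ext
    (λ m → subst (λ z → adj H₁ ℓ (punchIn ℓ (to f₀ z)) ≡ true) (sym (suc-injective (A.meet-new-only-a₀ (suc b) m)))
             (subst (λ z → adj H₁ ℓ z ≡ true)
                    (sym (trans (cong (punchIn ℓ) (strictlyInverseˡ f₀ p₀)) punchIn-p₀)) ℓ-p))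
    (λ a → let b≡a₀ = trans (sym (strictlyInverseʳ f₀ b))
                             (cong (from f₀) (punchIn-injective ℓ _ _ (trans (only-p _ a) (sym punchIn-p₀))))
           in subst (λ z → adj (treeOf A.extended) zero (suc z) ≡ true) (sym b≡a₀) A.meet-new-a₀)

  χ-adjacency : ∀ a b → adj (treeOf A.extended) a b ≡ adj H₁ (χ a) (χ b)
  χ-adjacency zero zero = trans (irr (treeOf A.extended) zero) (sym (irr H₁ ℓ))
  χ-adjacency zero (suc b) = new-adjacency b
  χ-adjacency (suc a) zero = trans (Graph.sym (treeOf A.extended) (suc a) zero)
                                   (trans (new-adjacency a) (Graph.sym H₁ _ _))
  χ-adjacency (suc a) (suc b) = trans (A.meet-old a b) (proj₂ ι₀ a b)

  grown : Realisation (suc (suc k)) H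
  grown = attach G₀ x , G∈𝒯 , A.extended ,
          ≅-trans {treeOf A.extended} {H₁} {H} (mk↔ₛ′ χ χ⁻ χχ⁻ χ⁻χ , χ-adjacency) (relabel-≅ H e)

realise : ∀ k (H : Graph) → V H ≡ suc k → IsTree H → (∀ x → deg H x ≤ 3) → Realisation (suc k) H
realise zero H e _ _ =
  K3 , base (≅-refl K3) , K3-triangleTree ,
  ≅-trans {treeOf K3-triangleTree} {relabel H e} {H}
    (↔-refl , λ { zero zero → trans (irr (treeOf K3-triangleTree) zero) (sym (irr (relabel H e) zero)) })
    (relabel-≅ H e)
realise (suc k) H e H-tree deg≤3 =
  let H₁ = relabel H e
      H₁≅H = relabel-≅ H e
      H₁-tree = tree-≅ (≅-sym {H₁} {H} H₁≅H) H-tree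
      deg₁≤3 : ∀ x → deg H₁ x ≤ 3
      deg₁≤3 x = subst (_≤ 3) (sym (deg-≅ {H₁} {H} H₁≅H x)) (deg≤3 _)
      (ℓ , deg-ℓ) = LeafOfTree.leaf H₁ H₁-tree zero (suc zero) (λ ())
      (p , ℓ-p) = from (neighbours↔deg H₁ ℓ) (subst Fin (sym deg-ℓ) zero)
      only-p = leaf-neighbour-unique H₁ deg-ℓ ℓ-p
      open Remove H e ℓ
      open Leaf p ℓ-p only-p
      rec = realise k H₀ refl (connected₀ (proj₁ H₁-tree) , acyclic₀ (proj₂ H₁-tree))
                              (λ i → ≤-trans (deg₀≤ i) (deg₁≤3 _))
  in Grow.grown H e deg₁≤3 ℓ p ℓ-p only-p rec

cliqueGraph-onto : ∀ n → 1 ≤ n → ∀ H → InA n H → Σ Graph (λ G → InTn n G × IsCliqueGraph G H)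
cliqueGraph-onto (suc k) _ H (V≡ , H-tree , deg≤3) =
  let (G , G∈𝒯 , T , T≅H) = realise k H V≡ H-tree deg≤3
  in G , (G∈𝒯 , CliquesOf.numTriangles≡ T) ,
     cliqueGraph-≅ {G} {treeOf T} {H} (CliquesOf.meetGraph-is-cliqueGraph T) T≅H

proposition1 : ∀ (n : ℕ) → 1 ≤ n →
      (∀ G → InTn n G → Σ Graph (λ H → IsCliqueGraph G H))
    × (∀ G H → InTn n G → IsCliqueGraph G H → InA n H)
    × (∀ G G' H H' → InTn n G → InTn n G' → IsCliqueGraph G H → IsCliqueGraph G' H'
         → H ≅ H' → G ≅ G')
    × (∀ H → InA n H → Σ Graph (λ G → InTn n G × IsCliqueGraph G H))
proposition1 n 1≤n =
  cliqueGraph-exists n , cliqueGraph-in-𝒜 n , cliqueGraph-injective n , cliqueGraph-onto n 1≤n
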